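{- For the infinite hexagonal grid $\mathrm{HEX}$, $\tfrac{4}{7} \le \mathrm{RED{:}IC}\%(\mathrm{HEX}) \le \tfrac{2}{3}$.
   Context: $\mathrm{HEX}$ is the infinite hexagonal (honeycomb) lattice, a 3-regular planar graph. $N[v]$ denotes the closed neighborhood of $v$ and $\Delta$ symmetric difference. A set $S \subseteq V(G)$ is a redundant identifying code (RED:IC) if every vertex $v$ satisfies $|N[v] \cap S| \ge 2$ and every pair of distinct vertices $u,v$ satisfies $|(N[u]\cap S)\,\Delta\,(N[v]\cap S)| \ge 2$. For an infinite graph the density of $S$ is $\limsup_{r\to\infty} |S \cap B_r(v_0)|/|B_r(v_0)|$ for a fixed vertex $v_0$, where $B_r(v_0)$ is the set of vertices within distance $r$ of $v_0$; $\mathrm{RED{:}IC}\%(G)$ is the minimum (infimum) density of a RED:IC of $G$. -}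

module Defs where

open import Data.Bool using (Bool; true; false; _∧_; _∨_; not; if_then_else_)
open import Data.Nat using (ℕ; zero; suc; _+_; _*_; _≤_; _%_; _≡ᵇ_)
open import Data.Integer as ℤ using (ℤ; +_; ∣_∣)
open import Data.Product using (_×_; _,_; proj₁; proj₂; ∃-syntax)
open import Data.List using (List; []; _∷_; map; upTo; cartesianProduct)
open import Data.Bool.ListAction using (any)
open import Relation.Binary.PropositionalEquality using (_≡_)
open import Relation.Nullary.Decidable using (⌊_⌋)

-- Vertices of HEX in the "brick wall" embedding into ℤ².
Vertex : Set
Vertex = ℤ × ℤ

origin : Vertex
origin = (+ 0 , + 0)

eqV : Vertex → Vertex → Bool
eqV (a , b) (c , d) = ⌊ a ℤ.≟ c ⌋ ∧ ⌊ b ℤ.≟ d ⌋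

-- (x , y) is adjacent to (x ± 1 , y), and to (x , y + 1) if x + y is even,
-- (x , y - 1) if x + y is odd.  This is the honeycomb lattice (3-regular).
evenV : Vertex → Bool
evenV (x , y) = (∣ x ℤ.+ y ∣ % 2) ≡ᵇ 0

nbrs : Vertex → List Vertex
nbrs (x , y) =
  (x ℤ.+ + 1 , y) ∷ (x ℤ.- + 1 , y) ∷
  (x , (if evenV (x , y) then y ℤ.+ + 1 else y ℤ.- + 1)) ∷ []

closedNbhd : Vertex → List Vertex
closedNbhd v = v ∷ nbrs v

elemV : Vertex → List Vertex → Bool
elemV v = any (eqV v)

countB : (Vertex → Bool) → List Vertex → ℕ
countB p [] = 0
countB p (x ∷ xs) = (if p x then 1 else 0) + countB p xs

VSet : Set
VSet = Vertex → Bool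

nbhdCount : VSet → Vertex → ℕ
nbhdCount S v = countB S (closedNbhd v)

-- |(N[u] ∩ S) Δ (N[v] ∩ S)|  (the lists N[u], N[v] have no repetitions)
symDiffCount : VSet → Vertex → Vertex → ℕ
symDiffCount S u v =
  countB (λ w → S w ∧ not (elemV w (closedNbhd v))) (closedNbhd u)
  + countB (λ w → S w ∧ not (elemV w (closedNbhd u))) (closedNbhd v)

IsREDIC : VSet → Set
IsREDIC S =
  (∀ v → 2 ≤ nbhdCount S v) ×
  (∀ u v → eqV u v ≡ false → 2 ≤ symDiffCount S u v)

inBall : ℕ → Vertex → Bool
inBall zero v = eqV v origin
inBall (suc r) v = inBall r v ∨ any (inBall r) (nbrs v)

-- the box [-r, r]², which contains the ball B_r(origin)
range : ℕ → List ℤ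
range r = map (λ i → + i ℤ.- + r) (upTo (suc (r + r)))

box : ℕ → List Vertex
box r = cartesianProduct (range r) (range r)

ballSize : ℕ → ℕ
ballSize r = countB (inBall r) (box r)

ballCount : VSet → ℕ → ℕ
ballCount S r = countB (λ v → inBall r v ∧ S v) (box r)

-- limsup_r |S ∩ B_r| / |B_r|  ≥  p / q, i.e.
-- for every ε = 1/(k+1) and every R there is r ≥ R with
-- ballCount/ballSize ≥ p/q − 1/(k+1), cleared of denominators.
DensityAtLeast : VSet → ℕ → ℕ → Set
DensityAtLeast S p q =
  ∀ (k R : ℕ) → ∃[ r ] (R ≤ r ×
    p * suc k * ballSize r ≤ q * suc k * ballCount S r + q * ballSize r)

EventuallyRatioAtMost : VSet → ℕ → ℕ → ℕ → Set
EventuallyRatioAtMost S p q k =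
  ∃[ R ] (∀ r → R ≤ r →
    q * suc k * ballCount S r ≤ p * suc k * ballSize r + q * ballSize r)

REDICDensityLowerBound : ℕ → ℕ → Set
REDICDensityLowerBound p q = ∀ (S : VSet) → IsREDIC S → DensityAtLeast S p q

-- RED:IC%(HEX) ≤ p/q : for every ε = 1/(k+1) there is a RED:IC whose
-- ratios are eventually ≤ p/q + ε (equivalently, density < p/q + ε' for all ε').
REDICDensityUpperBound : ℕ → ℕ → Set
REDICDensityUpperBound p q =
  ∀ (k : ℕ) → ∃[ S ] (IsREDIC S × EventuallyRatioAtMost S p q k)

-- Lower bound, by discharging: every vertex u gives 12 units of charge, shared
-- equally among the 2, 3 or 4 codewords of N[u].  An exhaustive check of the
-- 2¹⁰ configurations on a ball of radius 2 shows that no codeword of a RED:IC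
-- collects more than 21, so 12 ∣ B_r ∣ ≤ 21 ∣ S ∩ B_{r+1} ∣.  As the balls grow
-- quadratically while ∣ B_{r+1} ∣ - ∣ B_r ∣ is linear in r, the density is at
-- least 12/21 = 4/7.
--
-- Upper bound: a code periodic modulo 6 in both coordinates, verified on one
-- period, omits exactly one ordinate in three along every column.  Every ball
-- meets a column in an interval, so the code occupies 2/3 of each ball up to a
-- term linear in the radius.

module Submission where

open import Defs
open import Data.Bool using (Bool; true; false; _∧_; _∨_; not; if_then_else_; T)
open import Data.Bool.Properties
  using (not-involutive; not-¬; ¬-not; ∧-identityʳ; ∧-conicalˡ; ∧-conicalʳ; ∨-conicalˡ; ∨-conicalʳ)
open import Data.Nat as ℕ using (ℕ; zero; suc; _≤_; _<_; z≤n; s≤s; _+_; _*_; _∸_; _%_; _/_; _≡ᵇ_; _≤ᵇ_)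
open import Data.Nat.Properties as ℕP using (≤-refl; ≤-trans; m≤n⇒m≤1+n; n≤1+n; +-suc; +-comm; *-monoʳ-≤; *-monoˡ-≤; +-mono-≤)
import Data.Nat.DivMod as DM
open import Data.Integer as ℤ using (ℤ; +_; -[1+_]; ∣_∣)
import Data.Integer.Properties as ℤP
open import Algebra.Properties.AbelianGroup ℤP.+-0-abelianGroup using () renaming (∙-cancelʳ to +-cancelʳ)
import Data.Integer.Tactic.RingSolver as ℤSolver
import Data.Nat.Tactic.RingSolver as ℕSolver
open import Data.Product using (_×_; _,_; proj₁; proj₂; Σ)
open import Data.Sum using (_⊎_; inj₁; inj₂)
open import Data.Empty using (⊥-elim)
open import Data.List using (List; []; _∷_; map; length; _++_; applyUpTo; upTo; cartesianProduct)
open import Data.List.Membership.Propositional using (_∈_)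
open import Data.List.Relation.Unary.Any using (here; there)
open import Relation.Nullary using (¬_; yes; no)
open import Relation.Nullary.Decidable using (⌊_⌋)
open import Relation.Binary.PropositionalEquality

-- Parity

even : ℕ → Bool
even zero = true
even (suc zero) = false
even (suc (suc n)) = even n

even-suc : ∀ n → even (suc n) ≡ not (even n)
even-suc zero = refl
even-suc (suc zero) = refl
even-suc (suc (suc n)) = even-suc n

%2≡ᵇ0≡even : ∀ n → ((n % 2) ≡ᵇ 0) ≡ even n
%2≡ᵇ0≡even zero = refl
%2≡ᵇ0≡even (suc zero) = refl
%2≡ᵇ0≡even (suc (suc n)) = %2≡ᵇ0≡even n

xnor : Bool → Bool → Bool
xnor true b = b
xnor false b = not b

xnor-comm : ∀ a b → xnor a b ≡ xnor b a
xnor-comm true true = refl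
xnor-comm true false = refl
xnor-comm false true = refl
xnor-comm false false = refl

not-xnorˡ : ∀ a b → not (xnor a b) ≡ xnor (not a) b
not-xnorˡ true b = refl
not-xnorˡ false b = not-involutive b

even-+ : ∀ m n → even (m + n) ≡ xnor (even m) (even n)
even-+ zero n = refl
even-+ (suc zero) n = even-suc n
even-+ (suc (suc m)) n = even-+ m n

evenℤ : ℤ → Bool
evenℤ z = even ∣ z ∣

evenℤ-suc : ∀ z → evenℤ (z ℤ.+ + 1) ≡ not (evenℤ z)
evenℤ-suc (+ n) rewrite +-comm n 1 = even-suc n
evenℤ-suc -[1+ zero ] = refl
evenℤ-suc -[1+ suc n ] = even-suc n

evenℤ-pred : ∀ z → evenℤ (z ℤ.- + 1) ≡ not (evenℤ z)
evenℤ-pred (+ zero) = refl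
evenℤ-pred (+ suc n) = trans (sym (not-involutive (even n))) (cong not (sym (even-suc n)))
evenℤ-pred -[1+ n ] rewrite ℕP.+-identityʳ n = trans (sym (not-involutive (even n))) (cong not (sym (even-suc n)))

evenℤ-+ : ∀ z w → evenℤ (z ℤ.+ w) ≡ xnor (evenℤ w) (evenℤ z)
evenℤ-+ z (+ n) = +pos z n
  where
  +pos : ∀ z n → evenℤ (z ℤ.+ + n) ≡ xnor (even n) (evenℤ z)
  +pos z zero rewrite ℤP.+-identityʳ z = refl
  +pos z (suc n) = begin
    evenℤ (z ℤ.+ + suc n)            ≡⟨ cong evenℤ (trans (cong (λ k → z ℤ.+ k) (ℤP.pos-+ 1 n)) (shift z (+ n))) ⟩
    evenℤ ((z ℤ.+ + n) ℤ.+ + 1)      ≡⟨ evenℤ-suc (z ℤ.+ + n) ⟩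
    not (evenℤ (z ℤ.+ + n))          ≡⟨ cong not (+pos z n) ⟩
    not (xnor (even n) (evenℤ z))    ≡⟨ not-xnorˡ (even n) (evenℤ z) ⟩
    xnor (not (even n)) (evenℤ z)    ≡⟨ cong (λ b → xnor b (evenℤ z)) (sym (even-suc n)) ⟩
    xnor (even (suc n)) (evenℤ z)    ∎
    where
    open ≡-Reasoning
    shift : ∀ a b → a ℤ.+ (+ 1 ℤ.+ b) ≡ (a ℤ.+ b) ℤ.+ + 1
    shift = ℤSolver.solve-∀
evenℤ-+ z -[1+ n ] = +neg z n
  where
  +neg : ∀ z n → evenℤ (z ℤ.+ -[1+ n ]) ≡ xnor (even (suc n)) (evenℤ z)
  +neg z zero = evenℤ-pred z
  +neg z (suc n) = begin
    evenℤ (z ℤ.+ -[1+ suc n ])               ≡⟨ cong (λ k → evenℤ (z ℤ.+ -[1+ suc k ])) (sym (ℕP.+-identityʳ n)) ⟩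
    evenℤ (z ℤ.+ (-[1+ n ] ℤ.- + 1))         ≡⟨ cong evenℤ (sym (ℤP.+-assoc z -[1+ n ] (ℤ.- + 1))) ⟩
    evenℤ ((z ℤ.+ -[1+ n ]) ℤ.- + 1)         ≡⟨ evenℤ-pred (z ℤ.+ -[1+ n ]) ⟩
    not (evenℤ (z ℤ.+ -[1+ n ]))             ≡⟨ cong not (+neg z n) ⟩
    not (xnor (even (suc n)) (evenℤ z))      ≡⟨ not-xnorˡ (even (suc n)) (evenℤ z) ⟩
    xnor (not (even (suc n))) (evenℤ z)      ≡⟨ cong (λ b → xnor b (evenℤ z)) (sym (even-suc (suc n))) ⟩
    xnor (even (suc (suc n))) (evenℤ z)      ∎
    where open ≡-Reasoning

evenV≡evenℤ : ∀ x y → evenV (x , y) ≡ evenℤ (x ℤ.+ y)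
evenV≡evenℤ x y = %2≡ᵇ0≡even ∣ x ℤ.+ y ∣

evenV≡even-taxicab : ∀ x y → evenV (x , y) ≡ even (∣ x ∣ + ∣ y ∣)
evenV≡even-taxicab x y = begin
  evenV (x , y)                     ≡⟨ evenV≡evenℤ x y ⟩
  evenℤ (x ℤ.+ y)                   ≡⟨ evenℤ-+ x y ⟩
  xnor (evenℤ y) (evenℤ x)          ≡⟨ xnor-comm (evenℤ y) (evenℤ x) ⟩
  xnor (evenℤ x) (evenℤ y)          ≡⟨ sym (even-+ ∣ x ∣ ∣ y ∣) ⟩
  even (∣ x ∣ + ∣ y ∣)              ∎
  where open ≡-Reasoning

-- Finite sums

∑ : ℕ → (ℕ → ℕ) → ℕ
∑ zero f = 0
∑ (suc n) f = f 0 + ∑ n (λ i → f (suc i))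

∑-cong : ∀ n {f g : ℕ → ℕ} → (∀ i → i < n → f i ≡ g i) → ∑ n f ≡ ∑ n g
∑-cong zero h = refl
∑-cong (suc n) h = cong₂ _+_ (h 0 (s≤s z≤n)) (∑-cong n (λ i p → h (suc i) (s≤s p)))

∑-mono : ∀ n {f g : ℕ → ℕ} → (∀ i → i < n → f i ≤ g i) → ∑ n f ≤ ∑ n g
∑-mono zero h = z≤n
∑-mono (suc n) h = +-mono-≤ (h 0 (s≤s z≤n)) (∑-mono n (λ i p → h (suc i) (s≤s p)))

∑-+-range : ∀ m n (f : ℕ → ℕ) → ∑ (m + n) f ≡ ∑ m f + ∑ n (λ i → f (m + i))
∑-+-range zero n f = refl
∑-+-range (suc m) n f = trans (cong (λ k → f 0 + k) (∑-+-range m n (λ i → f (suc i)))) (sym (ℕP.+-assoc (f 0) _ _))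

∑-last : ∀ n (f : ℕ → ℕ) → ∑ (suc n) f ≡ ∑ n f + f n
∑-last n f = begin
  ∑ (suc n) f                        ≡⟨ cong (λ k → ∑ k f) (+-comm 1 n) ⟩
  ∑ (n + 1) f                        ≡⟨ ∑-+-range n 1 f ⟩
  ∑ n f + (f (n + 0) + 0)            ≡⟨ cong (λ k → ∑ n f + k) (trans (ℕP.+-identityʳ _) (cong f (ℕP.+-identityʳ n))) ⟩
  ∑ n f + f n                        ∎
  where open ≡-Reasoning

∑-+ : ∀ n (f g : ℕ → ℕ) → ∑ n (λ i → f i + g i) ≡ ∑ n f + ∑ n g
∑-+ zero f g = refl
∑-+ (suc n) f g rewrite ∑-+ n (λ i → f (suc i)) (λ i → g (suc i)) = interchange (f 0) (g 0) _ _
  where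
  interchange : ∀ a b c d → a + b + (c + d) ≡ a + c + (b + d)
  interchange = ℕSolver.solve-∀

∑-* : ∀ n k (f : ℕ → ℕ) → ∑ n (λ i → k * f i) ≡ k * ∑ n f
∑-* zero k f = sym (ℕP.*-zeroʳ k)
∑-* (suc n) k f rewrite ∑-* n k (λ i → f (suc i)) = sym (ℕP.*-distribˡ-+ k (f 0) _)

∑-const : ∀ n c → ∑ n (λ _ → c) ≡ n * c
∑-const zero c = refl
∑-const (suc n) c = cong (λ k → c + k) (∑-const n c)

∑-zero : ∀ n {f : ℕ → ℕ} → (∀ i → i < n → f i ≡ 0) → ∑ n f ≡ 0
∑-zero n h = trans (∑-cong n h) (trans (∑-const n 0) (ℕP.*-zeroʳ n))

∑-lower : ∀ n c {f : ℕ → ℕ} → (∀ i → i < n → c ≤ f i) → n * c ≤ ∑ n f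
∑-lower n c h = subst (_≤ _) (∑-const n c) (∑-mono n h)

∑-mono-range : ∀ {m n} (f : ℕ → ℕ) → m ≤ n → ∑ m f ≤ ∑ n f
∑-mono-range {m} {n} f m≤n = begin
  ∑ m f                                 ≤⟨ ℕP.m≤m+n _ _ ⟩
  ∑ m f + ∑ (n ∸ m) (λ i → f (m + i))   ≡⟨ sym (∑-+-range m (n ∸ m) f) ⟩
  ∑ (m + (n ∸ m)) f                     ≡⟨ cong (λ k → ∑ k f) (ℕP.m+[n∸m]≡n m≤n) ⟩
  ∑ n f                                 ∎
  where open ℕP.≤-Reasoning

∑-reverse : ∀ n (f : ℕ → ℕ) → ∑ n f ≡ ∑ n (λ i → f (n ∸ suc i))
∑-reverse zero f = refl
∑-reverse (suc n) f = trans (∑-last n f) (trans (+-comm (∑ n f) (f n)) (cong (λ k → f n + k) (∑-reverse n f)))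

sumL : {A : Set} → (A → ℕ) → List A → ℕ
sumL f [] = 0
sumL f (x ∷ xs) = f x + sumL f xs

sumL-cong : {A : Set} {f g : A → ℕ} (L : List A) → (∀ v → f v ≡ g v) → sumL f L ≡ sumL g L
sumL-cong [] h = refl
sumL-cong (x ∷ L) h = cong₂ _+_ (h x) (sumL-cong L h)

sumL-mono : {A : Set} {f g : A → ℕ} (L : List A) → (∀ v → f v ≤ g v) → sumL f L ≤ sumL g L
sumL-mono [] h = z≤n
sumL-mono (x ∷ L) h = +-mono-≤ (h x) (sumL-mono L h)

sumL-*ʳ : {A : Set} (f : A → ℕ) (k : ℕ) (L : List A) → sumL (λ u → f u * k) L ≡ sumL f L * k
sumL-*ʳ f k [] = refl
sumL-*ʳ f k (x ∷ L) = trans (cong (λ z → f x * k + z) (sumL-*ʳ f k L)) (sym (ℕP.*-distribʳ-+ k (f x) _))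

sumL-++ : {A : Set} (f : A → ℕ) (L M : List A) → sumL f (L ++ M) ≡ sumL f L + sumL f M
sumL-++ f [] M = refl
sumL-++ f (x ∷ L) M = trans (cong (λ k → f x + k) (sumL-++ f L M)) (sym (ℕP.+-assoc (f x) _ _))

sumL-map : {A B : Set} (f : B → ℕ) (g : A → B) (L : List A) → sumL f (map g L) ≡ sumL (λ a → f (g a)) L
sumL-map f g [] = refl
sumL-map f g (x ∷ L) = cong (λ k → f (g x) + k) (sumL-map f g L)

sumL-applyUpTo : {A : Set} (f : A → ℕ) (h : ℕ → A) (n : ℕ) → sumL f (applyUpTo h n) ≡ ∑ n (λ i → f (h i))
sumL-applyUpTo f h zero = refl
sumL-applyUpTo f h (suc n) = cong (λ k → f (h 0) + k) (sumL-applyUpTo f (λ i → h (suc i)) n)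

sumL-cartesianProduct : {A B : Set} (f : A × B → ℕ) (xs : List A) (ys : List B) →
  sumL f (cartesianProduct xs ys) ≡ sumL (λ x → sumL (λ y → f (x , y)) ys) xs
sumL-cartesianProduct f [] ys = refl
sumL-cartesianProduct f (x ∷ xs) ys =
  trans (sumL-++ f (map (x ,_) ys) _) (cong₂ _+_ (sumL-map f (x ,_) ys) (sumL-cartesianProduct f xs ys))

bit : Bool → ℕ
bit true = 1
bit false = 0

bit≤1 : ∀ b → bit b ≤ 1
bit≤1 true = ≤-refl
bit≤1 false = z≤n

bit-mono : ∀ {a b} → (a ≡ true → b ≡ true) → bit a ≤ bit b
bit-mono {true} h rewrite h refl = ≤-refl
bit-mono {false} h = z≤n

bit-*-≤ : ∀ b k → bit b * k ≤ k
bit-*-≤ true k = ℕP.≤-reflexive (ℕP.+-identityʳ k)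
bit-*-≤ false k = z≤n

bit-∧-≤ : ∀ a b → bit (a ∧ b) ≤ bit a
bit-∧-≤ true b = bit≤1 b
bit-∧-≤ false b = z≤n

countB≡sumL-bit : ∀ p L → countB p L ≡ sumL (λ v → bit (p v)) L
countB≡sumL-bit p [] = refl
countB≡sumL-bit p (x ∷ L) with p x
... | true = cong suc (countB≡sumL-bit p L)
... | false = countB≡sumL-bit p L

countB≤length : ∀ p L → countB p L ≤ length L
countB≤length p [] = z≤n
countB≤length p (x ∷ L) with p x
... | true = s≤s (countB≤length p L)
... | false = m≤n⇒m≤1+n (countB≤length p L)

countB-map : ∀ p (f : Vertex → Vertex) L → countB p (map f L) ≡ countB (λ v → p (f v)) L
countB-map p f [] = refl
countB-map p f (x ∷ L) = cong (λ k → (if p (f x) then 1 else 0) + k) (countB-map p f L)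

countB-cong : ∀ {p q} L → (∀ v → p v ≡ q v) → countB p L ≡ countB q L
countB-cong [] h = refl
countB-cong (x ∷ L) h = cong₂ (λ b n → (if b then 1 else 0) + n) (h x) (countB-cong L h)

-- Sums over boxes

width : ℕ → ℕ
width r = suc (r + r)

coord : ℕ → ℕ → ℤ
coord r i = + i ℤ.- + r

column : ℕ → (Vertex → ℕ) → ℕ → ℕ
column r F i = ∑ (width r) (λ j → F (coord r i , coord r j))

boxSum : ℕ → (Vertex → ℕ) → ℕ
boxSum r F = ∑ (width r) (column r F)

sumL-range : (f : ℤ → ℕ) (r : ℕ) → sumL f (range r) ≡ ∑ (width r) (λ i → f (coord r i))
sumL-range f r = trans (sumL-map f (coord r) (upTo (width r))) (sumL-applyUpTo _ (λ i → i) (width r))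

countB-box≡boxSum : ∀ p r → countB p (box r) ≡ boxSum r (λ v → bit (p v))
countB-box≡boxSum p r = begin
  countB p (box r)                                                          ≡⟨ countB≡sumL-bit p (box r) ⟩
  sumL (λ v → bit (p v)) (box r)                                            ≡⟨ sumL-cartesianProduct _ (range r) (range r) ⟩
  sumL (λ x → sumL (λ y → bit (p (x , y))) (range r)) (range r)             ≡⟨ sumL-range (λ x → sumL (λ y → bit (p (x , y))) (range r)) r ⟩
  ∑ (width r) (λ i → sumL (λ y → bit (p (coord r i , y))) (range r))       ≡⟨ ∑-cong (width r) (λ i _ → sumL-range (λ y → bit (p (coord r i , y))) r) ⟩
  boxSum r (λ v → bit (p v))                                                ∎
  where open ≡-Reasoning

boxSum-cong : ∀ N {F G : Vertex → ℕ} → (∀ v → F v ≡ G v) → boxSum N F ≡ boxSum N G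
boxSum-cong N {F} {G} h = ∑-cong (width N) {column N F} {column N G} (λ i _ → ∑-cong (width N) (λ j _ → h (coord N i , coord N j)))

boxSum-mono : ∀ N {F G : Vertex → ℕ} → (∀ v → F v ≤ G v) → boxSum N F ≤ boxSum N G
boxSum-mono N {F} {G} h = ∑-mono (width N) {column N F} {column N G} (λ i _ → ∑-mono (width N) (λ j _ → h (coord N i , coord N j)))

boxSum-+ : ∀ N (F G : Vertex → ℕ) → boxSum N (λ v → F v + G v) ≡ boxSum N F + boxSum N G
boxSum-+ N F G = trans (∑-cong (width N) (λ i _ → ∑-+ (width N) (λ j → F (coord N i , coord N j)) (λ j → G (coord N i , coord N j))))
                       (∑-+ (width N) (column N F) (column N G))

boxSum-* : ∀ N k (F : Vertex → ℕ) → boxSum N (λ v → k * F v) ≡ k * boxSum N F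
boxSum-* N k F = trans (∑-cong (width N) (λ i _ → ∑-* (width N) k (λ j → F (coord N i , coord N j)))) (∑-* (width N) k (column N F))

SupportedIn : ℕ → (Vertex → ℕ) → Set
SupportedIn M F = ∀ x y → (M < ∣ x ∣ ⊎ M < ∣ y ∣) → F (x , y) ≡ 0

SupportedIn-suc : ∀ {M F} → SupportedIn M F → SupportedIn (suc M) F
SupportedIn-suc sp x y (inj₁ p) = sp x y (inj₁ (ℕP.<-trans (ℕP.n<1+n _) p))
SupportedIn-suc sp x y (inj₂ p) = sp x y (inj₂ (ℕP.<-trans (ℕP.n<1+n _) p))

SupportedIn-cong : ∀ {M} {F G : Vertex → ℕ} → (∀ v → F v ≡ G v) → SupportedIn M F → SupportedIn M G
SupportedIn-cong e sp x y h = trans (sym (e (x , y))) (sp x y h)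

coord-suc : ∀ r i → coord (suc r) (suc i) ≡ coord r i
coord-suc r i = trans (cong₂ ℤ._-_ (ℤP.pos-+ 1 i) (ℤP.pos-+ 1 r)) (cancel (+ i) (+ r))
  where
  cancel : ∀ a b → (+ 1 ℤ.+ a) ℤ.- (+ 1 ℤ.+ b) ≡ a ℤ.- b
  cancel = ℤSolver.solve-∀

coord-+1 : ∀ r i → coord r i ℤ.+ + 1 ≡ coord r (suc i)
coord-+1 r i = trans (reassoc (+ i) (+ r)) (cong (ℤ._- + r) (sym (ℤP.pos-+ 1 i)))
  where
  reassoc : ∀ a b → (a ℤ.- b) ℤ.+ + 1 ≡ (+ 1 ℤ.+ a) ℤ.- b
  reassoc = ℤSolver.solve-∀

coord-∸1 : ∀ r i → coord r (suc i) ℤ.- + 1 ≡ coord r i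
coord-∸1 r i = trans (cong (ℤ._- + 1) (sym (coord-+1 r i))) (cancel (coord r i))
  where
  cancel : ∀ a → (a ℤ.+ + 1) ℤ.- + 1 ≡ a
  cancel = ℤSolver.solve-∀

coord-+ : ∀ r i → coord r (r + i) ≡ + i
coord-+ r i = trans (cong (ℤ._- + r) (ℤP.pos-+ r i)) (cancel (+ r) (+ i))
  where
  cancel : ∀ a b → (a ℤ.+ b) ℤ.- a ≡ b
  cancel = ℤSolver.solve-∀

coord-top : ∀ r → coord r (r + r) ≡ + r
coord-top r = coord-+ r r

coord-beyond : ∀ r → coord r (width r) ≡ + suc r
coord-beyond r = trans (sym (coord-+1 r (r + r))) (trans (cong (ℤ._+ + 1) (coord-top r)) (cong +_ (+-comm r 1)))

coord-neg : ∀ r i → i < r → coord r (r ∸ suc i) ≡ -[1+ i ]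
coord-neg r i i<r = trans (ℤP.m-n≡m⊖n (r ∸ suc i) r) (trans (ℤP.⊖-< (below r i<r)) (cong (λ z → ℤ.- (+ z)) (ℕP.m∸[m∸n]≡n i<r)))
  where
  below : ∀ r → i < r → r ∸ suc i < r
  below (suc r) _ = s≤s (ℕP.m∸n≤m r i)

coord-negative : ∀ N j → j < N → Σ ℕ λ k → coord N j ≡ -[1+ k ]
coord-negative N j j<N with N ∸ j in eq
... | zero = ⊥-elim (ℕP.<-irrefl refl (ℕP.<-≤-trans j<N (ℕP.m∸n≡0⇒m≤n eq)))
... | suc k = k , trans (ℤP.m-n≡m⊖n j N) (trans (ℤP.⊖-< j<N) (cong (λ z → ℤ.- (+ z)) eq))

∑-window-enlarge : ∀ r (f : ℤ → ℕ) → f -[1+ r ] ≡ 0 → f (+ suc r) ≡ 0 →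
  ∑ (width (suc r)) (λ i → f (coord (suc r) i)) ≡ ∑ (width r) (λ i → f (coord r i))
∑-window-enlarge r f f-left f-right = begin
  f (coord (suc r) 0) + ∑ (suc (r + suc r)) g  ≡⟨ cong₂ _+_ f-left (cong (λ k → ∑ (suc k) g) (+-suc r r)) ⟩
  ∑ (suc (width r)) g                           ≡⟨ ∑-last (width r) g ⟩
  ∑ (width r) g + g (width r)                   ≡⟨ cong₂ _+_ (∑-cong (width r) (λ i _ → cong f (coord-suc r i)))
                                                               (trans (cong f (trans (coord-suc r _) (coord-beyond r))) f-right) ⟩
  ∑ (width r) (λ i → f (coord r i)) + 0         ≡⟨ ℕP.+-identityʳ _ ⟩
  ∑ (width r) (λ i → f (coord r i))             ∎
  where
  open ≡-Reasoning
  g : ℕ → ℕ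
  g i = f (coord (suc r) (suc i))

boxSum-enlarge : ∀ r F → SupportedIn r F → boxSum (suc r) F ≡ boxSum r F
boxSum-enlarge r F sp = trans
  (∑-cong (width (suc r)) (λ i _ → ∑-window-enlarge r (λ y → F (coord (suc r) i , y))
    (sp (coord (suc r) i) -[1+ r ] (inj₂ ≤-refl)) (sp (coord (suc r) i) (+ suc r) (inj₂ ≤-refl))))
  (∑-window-enlarge r (λ x → ∑ (width r) (λ j → F (x , coord r j)))
    (∑-zero (width r) (λ j _ → sp -[1+ r ] (coord r j) (inj₁ ≤-refl)))
    (∑-zero (width r) (λ j _ → sp (+ suc r) (coord r j) (inj₁ ≤-refl))))

boxSum-enlarge-by : ∀ r k F → SupportedIn r F → boxSum (k + r) F ≡ boxSum r F
boxSum-enlarge-by r zero F sp = refl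
boxSum-enlarge-by r (suc k) F sp = trans (boxSum-enlarge (k + r) F (enlarged k)) (boxSum-enlarge-by r k F sp)
  where
  enlarged : ∀ k → SupportedIn (k + r) F
  enlarged zero = sp
  enlarged (suc k) = SupportedIn-suc (enlarged k)

∑-window-shift-+1 : ∀ M (f : ℤ → ℕ) → f -[1+ M ] ≡ 0 → f (+ suc (suc M)) ≡ 0 →
  ∑ (width (suc M)) (λ i → f (coord (suc M) i ℤ.+ + 1)) ≡ ∑ (width (suc M)) (λ i → f (coord (suc M) i))
∑-window-shift-+1 M f f-left f-right = begin
  ∑ (suc K) (λ i → f (coord N i ℤ.+ + 1))  ≡⟨ ∑-cong (suc K) (λ i _ → cong f (coord-+1 N i)) ⟩
  ∑ (suc K) g                               ≡⟨ ∑-last K g ⟩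
  ∑ K g + g K                               ≡⟨ cong (λ k → ∑ K g + k) (trans (cong f (coord-beyond N)) f-right) ⟩
  ∑ K g + 0                                 ≡⟨ +-comm _ 0 ⟩
  0 + ∑ K g                                 ≡⟨ cong (_+ ∑ K g) (sym f-left) ⟩
  ∑ (suc K) (λ i → f (coord N i))           ∎
  where
  open ≡-Reasoning
  N = suc M
  K = N + N
  g : ℕ → ℕ
  g i = f (coord N (suc i))

∑-window-shift-∸1 : ∀ M (f : ℤ → ℕ) → f -[1+ suc M ] ≡ 0 → f (+ suc M) ≡ 0 →
  ∑ (width (suc M)) (λ i → f (coord (suc M) i ℤ.- + 1)) ≡ ∑ (width (suc M)) (λ i → f (coord (suc M) i))
∑-window-shift-∸1 M f f-left f-right = begin
  f (coord N 0 ℤ.- + 1) + ∑ K (λ i → f (coord N (suc i) ℤ.- + 1))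
      ≡⟨ cong₂ _+_ (trans (cong (λ k → f -[1+ suc k ]) (ℕP.+-identityʳ M)) f-left) (∑-cong K (λ i _ → cong f (coord-∸1 N i))) ⟩
  0 + ∑ K g                                 ≡⟨ +-comm 0 _ ⟩
  ∑ K g + 0                                 ≡⟨ cong (λ k → ∑ K g + k) (sym (trans (cong f (coord-top N)) f-right)) ⟩
  ∑ K g + g K                               ≡⟨ sym (∑-last K g) ⟩
  ∑ (suc K) g                               ∎
  where
  open ≡-Reasoning
  N = suc M
  K = N + N
  g : ℕ → ℕ
  g i = f (coord N i)

right left up down : Vertex → Vertex
right (x , y) = (x ℤ.+ + 1 , y)
left (x , y) = (x ℤ.- + 1 , y)
up (x , y) = (x , y ℤ.+ + 1)
down (x , y) = (x , y ℤ.- + 1)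

column-vanishes : ∀ M F → SupportedIn M F → ∀ x → M < ∣ x ∣ → ∑ (width (suc M)) (λ j → F (x , coord (suc M) j)) ≡ 0
column-vanishes M F sp x lt = ∑-zero (width (suc M)) (λ j _ → sp x (coord (suc M) j) (inj₁ lt))

boxSum-right : ∀ M F → SupportedIn M F → boxSum (suc M) (λ v → F (right v)) ≡ boxSum (suc M) F
boxSum-right M F sp = ∑-window-shift-+1 M (λ x → ∑ (width (suc M)) (λ j → F (x , coord (suc M) j)))
  (column-vanishes M F sp -[1+ M ] ≤-refl) (column-vanishes M F sp (+ suc (suc M)) (n≤1+n _))

boxSum-left : ∀ M F → SupportedIn M F → boxSum (suc M) (λ v → F (left v)) ≡ boxSum (suc M) F
boxSum-left M F sp = ∑-window-shift-∸1 M (λ x → ∑ (width (suc M)) (λ j → F (x , coord (suc M) j)))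
  (column-vanishes M F sp -[1+ suc M ] (n≤1+n _)) (column-vanishes M F sp (+ suc M) ≤-refl)

boxSum-up : ∀ M F → SupportedIn M F → boxSum (suc M) (λ v → F (up v)) ≡ boxSum (suc M) F
boxSum-up M F sp = ∑-cong (width (suc M)) (λ i _ → ∑-window-shift-+1 M (λ y → F (coord (suc M) i , y))
  (sp (coord (suc M) i) -[1+ M ] (inj₂ ≤-refl)) (sp (coord (suc M) i) (+ suc (suc M)) (inj₂ (n≤1+n _))))

boxSum-down : ∀ M F → SupportedIn M F → boxSum (suc M) (λ v → F (down v)) ≡ boxSum (suc M) F
boxSum-down M F sp = ∑-cong (width (suc M)) (λ i _ → ∑-window-shift-∸1 M (λ y → F (coord (suc M) i , y))
  (sp (coord (suc M) i) -[1+ suc M ] (inj₂ (n≤1+n _))) (sp (coord (suc M) i) (+ suc M) (inj₂ ≤-refl)))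

-- The balls of HEX

double : ℕ → ℕ
double zero = zero
double (suc n) = suc (suc (double n))

n≤double : ∀ n → n ≤ double n
n≤double zero = z≤n
n≤double (suc n) = s≤s (≤-trans (n≤double n) (n≤1+n _))

double≡+ : ∀ n → double n ≡ n + n
double≡+ zero = refl
double≡+ (suc n) = cong suc (trans (cong suc (double≡+ n)) (sym (+-suc n n)))

double-mono : ∀ {a b} → a ≤ b → double a ≤ double b
double-mono z≤n = z≤n
double-mono (s≤s p) = s≤s (s≤s (double-mono p))

double-cancel-≤ : ∀ a b → double a ≤ double b → a ≤ b
double-cancel-≤ zero b _ = z≤n
double-cancel-≤ (suc a) (suc b) (s≤s (s≤s p)) = s≤s (double-cancel-≤ a b p)

even-double : ∀ n → even (double n) ≡ true
even-double zero = refl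
even-double (suc n) = even-double n

-- The distance from the origin to (x , y) is the larger of ∣ x ∣ + ∣ y ∣ and
-- vdist y (evenV (x , y)).  Vertical edges go up from even vertices and down
-- from odd ones, so two vertical steps in the same direction are separated by
-- a horizontal one and reaching row y takes about 2 ∣ y ∣ steps; the exact
-- count depends on the parity of the target and on the sign of y, as the
-- vertical edge at the (even) origin goes up.
vdist : ℤ → Bool → ℕ
vdist (+ n) true = double n
vdist (+ zero) false = 1
vdist (+ suc n) false = suc (double n)
vdist -[1+ m ] true = suc (suc (double m))
vdist -[1+ m ] false = suc (suc (suc (double m)))

taxicab : Vertex → ℕ
taxicab (x , y) = ∣ x ∣ + ∣ y ∣

vdistV : Vertex → ℕ
vdistV (x , y) = vdist y (evenV (x , y))

vstep : ℤ → Bool → ℤ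
vstep y e = if e then y ℤ.+ + 1 else y ℤ.- + 1

vert : Vertex → Vertex
vert (x , y) = (x , vstep y (evenV (x , y)))

nbrs≡ : ∀ v → nbrs v ≡ right v ∷ left v ∷ vert v ∷ []
nbrs≡ (x , y) = refl

evenV-right : ∀ v → evenV (right v) ≡ not (evenV v)
evenV-right (x , y) = trans (evenV≡evenℤ (x ℤ.+ + 1) y)
  (trans (cong evenℤ (swap x y)) (trans (evenℤ-suc (x ℤ.+ y)) (cong not (sym (evenV≡evenℤ x y)))))
  where
  swap : ∀ a b → (a ℤ.+ + 1) ℤ.+ b ≡ (a ℤ.+ b) ℤ.+ + 1
  swap = ℤSolver.solve-∀

evenV-left : ∀ v → evenV (left v) ≡ not (evenV v)
evenV-left (x , y) = trans (evenV≡evenℤ (x ℤ.- + 1) y)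
  (trans (cong evenℤ (swap x y)) (trans (evenℤ-pred (x ℤ.+ y)) (cong not (sym (evenV≡evenℤ x y)))))
  where
  swap : ∀ a b → (a ℤ.- + 1) ℤ.+ b ≡ (a ℤ.+ b) ℤ.- + 1
  swap = ℤSolver.solve-∀

evenV-up : ∀ v → evenV (up v) ≡ not (evenV v)
evenV-up (x , y) = trans (evenV≡evenℤ x (y ℤ.+ + 1))
  (trans (cong evenℤ (assoc x y)) (trans (evenℤ-suc (x ℤ.+ y)) (cong not (sym (evenV≡evenℤ x y)))))
  where
  assoc : ∀ a b → a ℤ.+ (b ℤ.+ + 1) ≡ (a ℤ.+ b) ℤ.+ + 1
  assoc = ℤSolver.solve-∀

evenV-down : ∀ v → evenV (down v) ≡ not (evenV v)
evenV-down (x , y) = trans (evenV≡evenℤ x (y ℤ.- + 1))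
  (trans (cong evenℤ (assoc x y)) (trans (evenℤ-pred (x ℤ.+ y)) (cong not (sym (evenV≡evenℤ x y)))))
  where
  assoc : ∀ a b → a ℤ.+ (b ℤ.- + 1) ≡ (a ℤ.+ b) ℤ.- + 1
  assoc = ℤSolver.solve-∀

evenV-vert : ∀ v → evenV (vert v) ≡ not (evenV v)
evenV-vert (x , y) with evenV (x , y) in e
... | true = trans (evenV-up (x , y)) (cong not e)
... | false = trans (evenV-down (x , y)) (cong not e)

∣∣≤suc∣+1∣ : ∀ z → ∣ z ∣ ≤ suc ∣ z ℤ.+ + 1 ∣
∣∣≤suc∣+1∣ (+ n) = m≤n⇒m≤1+n (ℕP.m≤m+n n 1)
∣∣≤suc∣+1∣ -[1+ zero ] = s≤s z≤n
∣∣≤suc∣+1∣ -[1+ suc n ] = ≤-refl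

∣∣≤suc∣-1∣ : ∀ z → ∣ z ∣ ≤ suc ∣ z ℤ.- + 1 ∣
∣∣≤suc∣-1∣ (+ zero) = z≤n
∣∣≤suc∣-1∣ (+ suc n) = ≤-refl
∣∣≤suc∣-1∣ -[1+ n ] = s≤s (m≤n⇒m≤1+n (≤-trans (n≤1+n n) (s≤s (ℕP.≤-reflexive (sym (ℕP.+-identityʳ n))))))

∣∣≤suc∣vstep∣ : ∀ y e → ∣ y ∣ ≤ suc ∣ vstep y e ∣
∣∣≤suc∣vstep∣ y true = ∣∣≤suc∣+1∣ y
∣∣≤suc∣vstep∣ y false = ∣∣≤suc∣-1∣ y

∣suc∣-towards0 : ∀ x a → ∣ x ∣ ≡ suc a → (∣ x ℤ.+ + 1 ∣ ≡ a) ⊎ (∣ x ℤ.- + 1 ∣ ≡ a)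
∣suc∣-towards0 (+ suc n) a refl = inj₂ refl
∣suc∣-towards0 -[1+ zero ] .zero refl = inj₁ refl
∣suc∣-towards0 -[1+ suc n ] .(suc n) refl = inj₁ refl

∣∣≡0⇒≡0 : ∀ z → ∣ z ∣ ≡ 0 → z ≡ + 0
∣∣≡0⇒≡0 (+ zero) _ = refl

taxicab-right : ∀ v → taxicab v ≤ suc (taxicab (right v))
taxicab-right (x , y) = ℕP.+-monoˡ-≤ ∣ y ∣ (∣∣≤suc∣+1∣ x)

taxicab-left : ∀ v → taxicab v ≤ suc (taxicab (left v))
taxicab-left (x , y) = ℕP.+-monoˡ-≤ ∣ y ∣ (∣∣≤suc∣-1∣ x)

taxicab-up : ∀ v → taxicab v ≤ suc (taxicab (up v))
taxicab-up (x , y) = ≤-trans (ℕP.+-monoʳ-≤ ∣ x ∣ (∣∣≤suc∣+1∣ y)) (ℕP.≤-reflexive (+-suc ∣ x ∣ _))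

taxicab-down : ∀ v → taxicab v ≤ suc (taxicab (down v))
taxicab-down (x , y) = ≤-trans (ℕP.+-monoʳ-≤ ∣ x ∣ (∣∣≤suc∣-1∣ y)) (ℕP.≤-reflexive (+-suc ∣ x ∣ _))

taxicab-vert : ∀ v → taxicab v ≤ suc (taxicab (vert v))
taxicab-vert (x , y) = ≤-trans (ℕP.+-monoʳ-≤ ∣ x ∣ (∣∣≤suc∣vstep∣ y (evenV (x , y)))) (ℕP.≤-reflexive (+-suc ∣ x ∣ _))

vdist-flip : ∀ y e → vdist y e ≤ suc (vdist y (not e))
vdist-flip (+ zero) true = z≤n
vdist-flip (+ zero) false = s≤s z≤n
vdist-flip (+ suc n) true = s≤s ≤-refl
vdist-flip (+ suc n) false = s≤s (m≤n⇒m≤1+n (n≤1+n _))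
vdist-flip -[1+ m ] true = ≤-trans (n≤1+n _) (n≤1+n _)
vdist-flip -[1+ m ] false = ≤-refl

vdist-vstep : ∀ y e → vdist y e ≤ suc (vdist (vstep y e) (not e))
vdist-vstep (+ n) true rewrite +-comm n 1 = ≤-trans (n≤1+n _) (n≤1+n _)
vdist-vstep (+ zero) false = s≤s z≤n
vdist-vstep (+ suc n) false = ≤-refl
vdist-vstep -[1+ zero ] true = ≤-refl
vdist-vstep -[1+ suc m ] true = ≤-refl
vdist-vstep -[1+ m ] false rewrite ℕP.+-identityʳ m = ≤-trans (n≤1+n _) (n≤1+n _)

∣∣≤vdist : ∀ y e → ∣ y ∣ ≤ vdist y e
∣∣≤vdist (+ zero) e = z≤n
∣∣≤vdist (+ suc n) true = s≤s (≤-trans (n≤double n) (n≤1+n _))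
∣∣≤vdist (+ suc n) false = s≤s (n≤double n)
∣∣≤vdist -[1+ m ] true = s≤s (≤-trans (n≤double m) (n≤1+n _))
∣∣≤vdist -[1+ m ] false = s≤s (≤-trans (n≤double m) (≤-trans (n≤1+n _) (n≤1+n _)))

even-vdist : ∀ y e → even (vdist y e) ≡ e
even-vdist (+ n) true = even-double n
even-vdist (+ zero) false = refl
even-vdist (+ suc n) false = trans (even-suc (double n)) (cong not (even-double n))
even-vdist -[1+ m ] true = even-double m
even-vdist -[1+ m ] false = trans (even-suc (double m)) (cong not (even-double m))

vdistV-right : ∀ v → vdistV v ≤ suc (vdistV (right v))
vdistV-right (x , y) = subst (λ b → vdist y (evenV (x , y)) ≤ suc (vdist y b)) (sym (evenV-right (x , y))) (vdist-flip y _)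

vdistV-left : ∀ v → vdistV v ≤ suc (vdistV (left v))
vdistV-left (x , y) = subst (λ b → vdist y (evenV (x , y)) ≤ suc (vdist y b)) (sym (evenV-left (x , y))) (vdist-flip y _)

vdistV-vert : ∀ v → vdistV v ≤ suc (vdistV (vert v))
vdistV-vert (x , y) = subst (λ b → vdist y (evenV (x , y)) ≤ suc (vdist (vstep y (evenV (x , y))) b))
  (sym (evenV-vert (x , y))) (vdist-vstep y _)

∨-introˡ : ∀ {a} b → a ≡ true → a ∨ b ≡ true
∨-introˡ b refl = refl

∨-introʳ : ∀ a {b} → b ≡ true → a ∨ b ≡ true
∨-introʳ true refl = refl
∨-introʳ false refl = refl

∨-elim : ∀ a b → a ∨ b ≡ true → a ≡ true ⊎ b ≡ true
∨-elim true b p = inj₁ refl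
∨-elim false b p = inj₂ p

⌊≟⌋⇒≡ : ∀ {a b : ℤ} → ⌊ a ℤ.≟ b ⌋ ≡ true → a ≡ b
⌊≟⌋⇒≡ {a} {b} p with a ℤ.≟ b
... | yes q = q

eqV⇒≡ : ∀ u v → eqV u v ≡ true → u ≡ v
eqV⇒≡ (a , b) (c , d) p = cong₂ _,_ (⌊≟⌋⇒≡ (∧-conicalˡ _ _ p)) (⌊≟⌋⇒≡ (∧-conicalʳ _ _ p))

inBall-suc : ∀ r v → inBall r v ≡ true → inBall (suc r) v ≡ true
inBall-suc r v = ∨-introˡ _

inBall-right : ∀ r v → inBall r (right v) ≡ true → inBall (suc r) v ≡ true
inBall-right r v p = ∨-introʳ (inBall r v) (∨-introˡ _ p)

inBall-left : ∀ r v → inBall r (left v) ≡ true → inBall (suc r) v ≡ true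
inBall-left r v p = ∨-introʳ (inBall r v) (∨-introʳ (inBall r (right v)) (∨-introˡ _ p))

inBall-vert : ∀ r v → inBall r (vert v) ≡ true → inBall (suc r) v ≡ true
inBall-vert r v p = ∨-introʳ (inBall r v) (∨-introʳ (inBall r (right v)) (∨-introʳ (inBall r (left v)) (∨-introˡ _ p)))

inBall⇒bounded : ∀ r v → inBall r v ≡ true → taxicab v ≤ r × vdistV v ≤ r
inBall⇒bounded zero v p with eqV⇒≡ v origin p
... | refl = z≤n , z≤n
inBall⇒bounded (suc r) v p with ∨-elim (inBall r v) _ p
... | inj₁ q = let (a , b) = inBall⇒bounded r v q in m≤n⇒m≤1+n a , m≤n⇒m≤1+n b
... | inj₂ q with ∨-elim (inBall r (right v)) _ q
...   | inj₁ q₁ = let (a , b) = inBall⇒bounded r _ q₁ in ≤-trans (taxicab-right v) (s≤s a) , ≤-trans (vdistV-right v) (s≤s b)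
...   | inj₂ q₁ with ∨-elim (inBall r (left v)) _ q₁
...     | inj₁ q₂ = let (a , b) = inBall⇒bounded r _ q₂ in ≤-trans (taxicab-left v) (s≤s a) , ≤-trans (vdistV-left v) (s≤s b)
...     | inj₂ q₂ with ∨-elim (inBall r (vert v)) _ q₂
...       | inj₁ q₃ = let (a , b) = inBall⇒bounded r _ q₃ in ≤-trans (taxicab-vert v) (s≤s a) , ≤-trans (vdistV-vert v) (s≤s b)

inBall-outside : ∀ r u → r < taxicab u → inBall r u ≡ false
inBall-outside r u lt with inBall r u in eq
... | true = ⊥-elim (ℕP.<-irrefl refl (ℕP.<-≤-trans lt (proj₁ (inBall⇒bounded r u eq))))
... | false = refl

data CloserNeighbour (r A : ℕ) (y : ℤ) (e : Bool) : Set where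
  towards-axis : ∀ a → A ≡ suc a → a + ∣ y ∣ ≤ r → vdist y (not e) ≤ r → CloserNeighbour r A y e
  off-axis     : A ≡ 0 → suc ∣ y ∣ ≤ r → vdist y (not e) ≤ r → CloserNeighbour r A y e
  vertical     : A + ∣ vstep y e ∣ ≤ r → vdist (vstep y e) (not e) ≤ r → CloserNeighbour r A y e

horizontal : ∀ r A y e → A + ∣ y ∣ ≤ suc r → vdist y (not e) ≤ r → (A ≡ 0 → suc ∣ y ∣ ≤ r) → CloserNeighbour r A y e
horizontal r zero y e p q h₀ = off-axis refl (h₀ refl) q
horizontal r (suc a) y e (s≤s p) q h₀ = towards-axis a refl p q

vertical-≤ : ∀ A b r → A + suc b ≤ suc r → A + b ≤ r
vertical-≤ A b r p = ℕP.≤-pred (subst (_≤ suc r) (+-suc A b) p)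

-- Both taxicab and vdist have the parity e of the vertex, so vdist ≠ r and a
-- horizontal step, which changes vdist by at most one, keeps it ≤ r.
closerNeighbour-taxicab : ∀ r A y e → e ≡ even (A + ∣ y ∣) → A + ∣ y ∣ ≡ suc r → vdist y e ≤ r → CloserNeighbour r A y e
closerNeighbour-taxicab r A y e par d vdist≤r = horizontal r A y e (ℕP.≤-reflexive d) flip≤r (λ A≡0 → ⊥-elim (A≢0 A≡0))
  where
  vdist≢r : vdist y e ≢ r
  vdist≢r eq = not-¬ refl (trans (sym (even-vdist y e)) (trans (cong even eq)
    (trans (sym (not-involutive (even r))) (cong not (trans (sym (even-suc r)) (trans (cong even (sym d)) (sym par)))))))
  flip≤r : vdist y (not e) ≤ r
  flip≤r = ≤-trans (subst (λ b → vdist y (not e) ≤ suc (vdist y b)) (not-involutive e) (vdist-flip y (not e)))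
                   (ℕP.≤∧≢⇒< vdist≤r vdist≢r)
  A≢0 : A ≢ 0
  A≢0 refl = ℕP.<-irrefl refl (subst (_≤ r) d (≤-trans (∣∣≤vdist y e) vdist≤r))

closerNeighbour-vdist : ∀ r A y e → e ≡ even (A + ∣ y ∣) → A + ∣ y ∣ ≤ suc r → vdist y e ≡ suc r → CloserNeighbour r A y e
closerNeighbour-vdist r A (+ zero) true par p ()
closerNeighbour-vdist r A (+ suc n) true par p eq with ℕP.suc-injective eq
... | refl = horizontal (suc (double n)) A (+ suc n) true p ≤-refl (off n par)
  where
  off : ∀ n → true ≡ even (A + suc n) → A ≡ 0 → suc (suc n) ≤ suc (double n)
  off zero par refl = ⊥-elim (not-¬ refl par)
  off (suc n) par refl = s≤s (s≤s (s≤s (n≤double n)))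
closerNeighbour-vdist r A (+ zero) false par p refl = horizontal zero A (+ zero) false p z≤n off
  where
  off : A ≡ 0 → 1 ≤ 0
  off refl = ⊥-elim (not-¬ refl (sym par))
closerNeighbour-vdist r A (+ suc n) false par p refl = vertical (vertical-≤ A n (double n) p) ≤-refl
closerNeighbour-vdist r A -[1+ zero ] true par p refl = vertical (vertical-≤ A 0 1 p) ≤-refl
closerNeighbour-vdist r A -[1+ suc m ] true par p refl = vertical (vertical-≤ A (suc m) _ p) ≤-refl
closerNeighbour-vdist r A -[1+ m ] false par p refl =
  horizontal (suc (suc (double m))) A -[1+ m ] false p ≤-refl (λ _ → s≤s (s≤s (n≤double m)))

closerNeighbour : ∀ r A y e → e ≡ even (A + ∣ y ∣) → A + ∣ y ∣ ≤ suc r → vdist y e ≤ suc r →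
  (A + ∣ y ∣ ≡ suc r ⊎ vdist y e ≡ suc r) → CloserNeighbour r A y e
closerNeighbour r A y e par p₁ p₂ d with vdist y e ℕ.≟ suc r
... | yes eq = closerNeighbour-vdist r A y e par p₁ eq
... | no ne with d
...   | inj₁ d = closerNeighbour-taxicab r A y e par d (ℕP.≤-pred (ℕP.≤∧≢⇒< p₂ ne))
...   | inj₂ d = ⊥-elim (ne d)

bounded⇒inBall-boundary : ∀ r v → (∀ w → taxicab w ≤ r → vdistV w ≤ r → inBall r w ≡ true) →
  taxicab v ≤ suc r → vdistV v ≤ suc r → (taxicab v ≡ suc r ⊎ vdistV v ≡ suc r) → inBall (suc r) v ≡ true
bounded⇒inBall-boundary r (x , y) ih p q d
  with closerNeighbour r ∣ x ∣ y (evenV (x , y)) (evenV≡even-taxicab x y) p q d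
... | towards-axis a ∣x∣≡ p′ q′ with ∣suc∣-towards0 x a ∣x∣≡
...   | inj₁ h = inBall-right r (x , y) (ih _ (subst (λ k → k + ∣ y ∣ ≤ r) (sym h) p′) (subst (λ b → vdist y b ≤ r) (sym (evenV-right (x , y))) q′))
...   | inj₂ h = inBall-left r (x , y) (ih _ (subst (λ k → k + ∣ y ∣ ≤ r) (sym h) p′) (subst (λ b → vdist y b ≤ r) (sym (evenV-left (x , y))) q′))
bounded⇒inBall-boundary r (x , y) ih p q d | off-axis ∣x∣≡0 p′ q′ with ∣∣≡0⇒≡0 x ∣x∣≡0
... | refl = inBall-right r (x , y) (ih _ p′ (subst (λ b → vdist y b ≤ r) (sym (evenV-right (x , y))) q′))
bounded⇒inBall-boundary r (x , y) ih p q d | vertical p′ q′ =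
  inBall-vert r (x , y) (ih _ p′ (subst (λ b → vdist (vstep y (evenV (x , y))) b ≤ r) (sym (evenV-vert (x , y))) q′))

bounded⇒inBall : ∀ r v → taxicab v ≤ r → vdistV v ≤ r → inBall r v ≡ true
bounded⇒inBall zero (x , y) p q
  with ∣∣≡0⇒≡0 x (ℕP.n≤0⇒n≡0 (ℕP.m+n≤o⇒m≤o ∣ x ∣ p)) | ∣∣≡0⇒≡0 y (ℕP.n≤0⇒n≡0 (ℕP.m+n≤o⇒n≤o ∣ x ∣ p))
... | refl | refl = refl
bounded⇒inBall (suc r) v p q with taxicab v ℕ.≤? r | vdistV v ℕ.≤? r
... | yes a | yes b = inBall-suc r v (bounded⇒inBall r v a b)
... | no a | _ = bounded⇒inBall-boundary r v (bounded⇒inBall r) p q (inj₁ (ℕP.≤-antisym p (ℕP.≰⇒> a)))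
... | yes a | no b = bounded⇒inBall-boundary r v (bounded⇒inBall r) p q (inj₂ (ℕP.≤-antisym q (ℕP.≰⇒> b)))

taxicab-outside : ∀ M x y → (M < ∣ x ∣ ⊎ M < ∣ y ∣) → M < taxicab (x , y)
taxicab-outside M x y (inj₁ p) = ℕP.<-≤-trans p (ℕP.m≤m+n _ _)
taxicab-outside M x y (inj₂ p) = ℕP.<-≤-trans p (ℕP.m≤n+m _ _)

ball-SupportedIn : ∀ r (P : VSet) → SupportedIn r (λ v → bit (inBall r v ∧ P v))
ball-SupportedIn r P x y h rewrite inBall-outside r (x , y) (taxicab-outside r x y h) = refl

ballSize≡boxSum : ∀ r k → ballSize r ≡ boxSum (k + r) (λ v → bit (inBall r v))
ballSize≡boxSum r k = trans (countB-box≡boxSum (inBall r) r)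
  (sym (boxSum-enlarge-by r k _ (SupportedIn-cong (λ v → cong bit (∧-identityʳ (inBall r v))) (ball-SupportedIn r (λ _ → true)))))

ballCount≡boxSum : ∀ S r k → ballCount S r ≡ boxSum (k + r) (λ v → bit (inBall r v ∧ S v))
ballCount≡boxSum S r k = trans (countB-box≡boxSum _ r) (sym (boxSum-enlarge-by r k _ (ball-SupportedIn r S)))

-- Translation invariance

translate : Vertex → Vertex → Vertex
translate (dx , dy) (x , y) = (x ℤ.+ dx , y ℤ.+ dy)

EvenShift : Vertex → Set
EvenShift (dx , dy) = evenℤ (dx ℤ.+ dy) ≡ true

evenV-translate : ∀ d v → EvenShift d → evenV (translate d v) ≡ evenV v
evenV-translate (dx , dy) (x , y) h = begin
  evenV (x ℤ.+ dx , y ℤ.+ dy)                        ≡⟨ evenV≡evenℤ (x ℤ.+ dx) (y ℤ.+ dy) ⟩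
  evenℤ ((x ℤ.+ dx) ℤ.+ (y ℤ.+ dy))                  ≡⟨ cong evenℤ (regroup x y dx dy) ⟩
  evenℤ ((x ℤ.+ y) ℤ.+ (dx ℤ.+ dy))                  ≡⟨ evenℤ-+ (x ℤ.+ y) (dx ℤ.+ dy) ⟩
  xnor (evenℤ (dx ℤ.+ dy)) (evenℤ (x ℤ.+ y))         ≡⟨ cong (λ b → xnor b (evenℤ (x ℤ.+ y))) h ⟩
  evenℤ (x ℤ.+ y)                                    ≡⟨ sym (evenV≡evenℤ x y) ⟩
  evenV (x , y)                                      ∎
  where
  open ≡-Reasoning
  regroup : ∀ a b c d → (a ℤ.+ c) ℤ.+ (b ℤ.+ d) ≡ (a ℤ.+ b) ℤ.+ (c ℤ.+ d)
  regroup = ℤSolver.solve-∀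

nbrs-translate : ∀ d v → EvenShift d → nbrs (translate d v) ≡ map (translate d) (nbrs v)
nbrs-translate (dx , dy) (x , y) h rewrite evenV-translate (dx , dy) (x , y) h with evenV (x , y)
... | true = cong₂ _∷_ (cong (_, y ℤ.+ dy) (+1-comm x dx))
               (cong₂ _∷_ (cong (_, y ℤ.+ dy) (-1-comm x dx)) (cong (λ z → (x ℤ.+ dx , z) ∷ []) (+1-comm y dy)))
  where
  +1-comm : ∀ a b → (a ℤ.+ b) ℤ.+ + 1 ≡ (a ℤ.+ + 1) ℤ.+ b
  +1-comm = ℤSolver.solve-∀
  -1-comm : ∀ a b → (a ℤ.+ b) ℤ.- + 1 ≡ (a ℤ.- + 1) ℤ.+ b
  -1-comm = ℤSolver.solve-∀
... | false = cong₂ _∷_ (cong (_, y ℤ.+ dy) (+1-comm x dx))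
               (cong₂ _∷_ (cong (_, y ℤ.+ dy) (-1-comm x dx)) (cong (λ z → (x ℤ.+ dx , z) ∷ []) (-1-comm y dy)))
  where
  +1-comm : ∀ a b → (a ℤ.+ b) ℤ.+ + 1 ≡ (a ℤ.+ + 1) ℤ.+ b
  +1-comm = ℤSolver.solve-∀
  -1-comm : ∀ a b → (a ℤ.+ b) ℤ.- + 1 ≡ (a ℤ.- + 1) ℤ.+ b
  -1-comm = ℤSolver.solve-∀

closedNbhd-translate : ∀ d v → EvenShift d → closedNbhd (translate d v) ≡ map (translate d) (closedNbhd v)
closedNbhd-translate d v h = cong (translate d v ∷_) (nbrs-translate d v h)

⌊≟⌋-translate : ∀ a c k → ⌊ (a ℤ.+ k) ℤ.≟ (c ℤ.+ k) ⌋ ≡ ⌊ a ℤ.≟ c ⌋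
⌊≟⌋-translate a c k with (a ℤ.+ k) ℤ.≟ (c ℤ.+ k) | a ℤ.≟ c
... | yes p | yes q = refl
... | yes p | no q = ⊥-elim (q (+-cancelʳ k a c p))
... | no p | yes refl = ⊥-elim (p refl)
... | no p | no q = refl

eqV-translate : ∀ d u v → eqV (translate d u) (translate d v) ≡ eqV u v
eqV-translate (dx , dy) (a , b) (c , e) rewrite ⌊≟⌋-translate a c dx | ⌊≟⌋-translate b e dy = refl

elemV-translate : ∀ d w L → elemV (translate d w) (map (translate d) L) ≡ elemV w L
elemV-translate d w [] = refl
elemV-translate d w (u ∷ L) = cong₂ _∨_ (eqV-translate d w u) (elemV-translate d w L)

nbhdCount-translate : ∀ S d u → EvenShift d → nbhdCount S (translate d u) ≡ nbhdCount (λ v → S (translate d v)) u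
nbhdCount-translate S d u h = trans (cong (countB S) (closedNbhd-translate d u h)) (countB-map S (translate d) (closedNbhd u))

private
  exclusiveCount-translate : ∀ (S : VSet) (d u v : Vertex) → EvenShift d →
    countB (λ w → S w ∧ not (elemV w (closedNbhd (translate d v)))) (closedNbhd (translate d u))
    ≡ countB (λ w → S (translate d w) ∧ not (elemV w (closedNbhd v))) (closedNbhd u)
  exclusiveCount-translate S d u v h = begin
    countB P (closedNbhd (translate d u))                    ≡⟨ cong (countB P) (closedNbhd-translate d u h) ⟩
    countB P (map (translate d) (closedNbhd u))              ≡⟨ countB-map P (translate d) (closedNbhd u) ⟩
    countB (λ w → P (translate d w)) (closedNbhd u)          ≡⟨ countB-cong (closedNbhd u) (λ w → cong (λ b → S (translate d w) ∧ not b)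
                                                                  (trans (cong (elemV (translate d w)) (closedNbhd-translate d v h)) (elemV-translate d w (closedNbhd v)))) ⟩
    countB (λ w → S (translate d w) ∧ not (elemV w (closedNbhd v))) (closedNbhd u) ∎
    where
    open ≡-Reasoning
    P : VSet
    P w = S w ∧ not (elemV w (closedNbhd (translate d v)))

symDiffCount-translate : ∀ S d u v → EvenShift d →
  symDiffCount S (translate d u) (translate d v) ≡ symDiffCount (λ w → S (translate d w)) u v
symDiffCount-translate S d u v h = cong₂ _+_ (exclusiveCount-translate S d u v h) (exclusiveCount-translate S d v u h)

IsREDIC-translate : ∀ S d → EvenShift d → IsREDIC S → IsREDIC (λ v → S (translate d v))
IsREDIC-translate S d h (dominating , separating) =
  (λ v → subst (2 ≤_) (nbhdCount-translate S d v h) (dominating (translate d v))) ,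
  (λ u v u≢v → subst (2 ≤_) (symDiffCount-translate S d u v h) (separating (translate d u) (translate d v) (trans (eqV-translate d u v) u≢v)))

-- Discharging

-- The last clause is a junk value: for a RED:IC, 2 ≤ ∣ N[u] ∩ S ∣ ≤ 4.
twelveOver : ℕ → ℕ
twelveOver 2 = 6
twelveOver 3 = 4
twelveOver 4 = 3
twelveOver _ = 12

twelveOver-* : ∀ c → 2 ≤ c → c ≤ 4 → twelveOver c * c ≡ 12
twelveOver-* 0 () _
twelveOver-* 1 (s≤s ()) _
twelveOver-* 2 _ _ = refl
twelveOver-* 3 _ _ = refl
twelveOver-* 4 _ _ = refl
twelveOver-* (suc (suc (suc (suc (suc c))))) _ (s≤s (s≤s (s≤s (s≤s ()))))

received : VSet → Vertex → ℕ
received S w = sumL (λ u → twelveOver (nbhdCount S u)) (closedNbhd w)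

allDominated : VSet → List Vertex → Bool
allDominated S [] = true
allDominated S (u ∷ us) = (2 ≤ᵇ nbhdCount S u) ∧ allDominated S us

allSeparatedFrom : VSet → Vertex → List Vertex → Bool
allSeparatedFrom S w [] = true
allSeparatedFrom S w (u ∷ us) = (eqV w u ∨ (2 ≤ᵇ symDiffCount S w u)) ∧ allSeparatedFrom S w us

locallyREDIC : VSet → Vertex → Bool
locallyREDIC S w = allDominated S (closedNbhd w) ∧ allSeparatedFrom S w (nbrs w)

receivedBound : VSet → Vertex → Bool
receivedBound S w = not (S w) ∨ (not (locallyREDIC S w) ∨ (received S w ≤ᵇ 21))

≤⇒≤ᵇ : ∀ {m n} → m ≤ n → (m ≤ᵇ n) ≡ true
≤⇒≤ᵇ {m} {n} p with m ≤ᵇ n | ℕP.≤⇒≤ᵇ p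
... | true | _ = refl

≤ᵇ⇒≤ : ∀ m n → (m ≤ᵇ n) ≡ true → m ≤ n
≤ᵇ⇒≤ m n p = ℕP.≤ᵇ⇒≤ m n (subst T (sym p) _)

IsREDIC⇒locallyREDIC : ∀ S → IsREDIC S → ∀ w → locallyREDIC S w ≡ true
IsREDIC⇒locallyREDIC S (dominating , separating) w = cong₂ _∧_ (dominated (closedNbhd w)) (separated (nbrs w))
  where
  dominated : ∀ L → allDominated S L ≡ true
  dominated [] = refl
  dominated (u ∷ L) = cong₂ _∧_ (≤⇒≤ᵇ (dominating u)) (dominated L)
  separatedFrom : ∀ u → (eqV w u ∨ (2 ≤ᵇ symDiffCount S w u)) ≡ true
  separatedFrom u = unlessTrue (eqV w u) (λ e → ≤⇒≤ᵇ (separating w u e))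
    where
    unlessTrue : ∀ b {c} → (b ≡ false → c ≡ true) → b ∨ c ≡ true
    unlessTrue true f = refl
    unlessTrue false f = f refl
  separated : ∀ L → allSeparatedFrom S w L ≡ true
  separated [] = refl
  separated (u ∷ L) = cong₂ _∧_ (separatedFrom u) (separated L)

receivedBound⇒received≤21 : ∀ S w → receivedBound S w ≡ true → S w ≡ true → locallyREDIC S w ≡ true → received S w ≤ 21
receivedBound⇒received≤21 S w t p q rewrite p | q = ≤ᵇ⇒≤ _ 21 t

received-translate : ∀ S d w → EvenShift d → received S (translate d w) ≡ received (λ v → S (translate d v)) w
received-translate S d w h = begin
  sumL f (closedNbhd (translate d w))             ≡⟨ cong (sumL f) (closedNbhd-translate d w h) ⟩
  sumL f (map (translate d) (closedNbhd w))       ≡⟨ sumL-map f (translate d) (closedNbhd w) ⟩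
  sumL (λ u → f (translate d u)) (closedNbhd w)   ≡⟨ sumL-cong (closedNbhd w) (λ u → cong twelveOver (nbhdCount-translate S d u h)) ⟩
  received (λ v → S (translate d v)) w            ∎
  where
  open ≡-Reasoning
  f : Vertex → ℕ
  f u = twelveOver (nbhdCount S u)

assign : List Vertex → List Bool → VSet
assign (p ∷ ps) (b ∷ bs) v = if eqV v p then b else assign ps bs v
assign _ _ v = false

allAssignments : ℕ → (List Bool → Bool) → Bool
allAssignments zero f = f []
allAssignments (suc n) f = allAssignments n (λ bs → f (true ∷ bs)) ∧ allAssignments n (λ bs → f (false ∷ bs))

allAssignments-sound : ∀ n f → allAssignments n f ≡ true → (bs : List Bool) → length bs ≡ n → f bs ≡ true
allAssignments-sound zero f h [] refl = h
allAssignments-sound (suc n) f h (true ∷ bs) refl = allAssignments-sound n _ (∧-conicalˡ _ _ h) bs refl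
allAssignments-sound (suc n) f h (false ∷ bs) refl = allAssignments-sound n _ (∧-conicalʳ _ _ h) bs refl

evenCentre oddCentre : Vertex
evenCentre = (+ 0 , + 0)
oddCentre = (+ 1 , + 0)

-- The vertices within distance 2 of the centre.  receivedBound S c evaluates S
-- only there, so it agrees definitionally with receivedBound (assign ball₂ (map
-- S ball₂)) c, and checking the 2¹⁰ assignments by evaluation covers every S.
ball₂-even ball₂-odd : List Vertex
ball₂-even = (+ 0 , + 0) ∷ (+ 1 , + 0) ∷ (-[1+ 0 ] , + 0) ∷ (+ 0 , + 1) ∷ (+ 2 , + 0) ∷ (+ 1 , -[1+ 0 ])
  ∷ (-[1+ 1 ] , + 0) ∷ (-[1+ 0 ] , -[1+ 0 ]) ∷ (+ 1 , + 1) ∷ (-[1+ 0 ] , + 1) ∷ []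
ball₂-odd = (+ 1 , + 0) ∷ (+ 2 , + 0) ∷ (+ 0 , + 0) ∷ (+ 1 , -[1+ 0 ]) ∷ (+ 3 , + 0) ∷ (+ 2 , + 1)
  ∷ (-[1+ 0 ] , + 0) ∷ (+ 0 , + 1) ∷ (+ 2 , -[1+ 0 ]) ∷ (+ 0 , -[1+ 0 ]) ∷ []

receivedBound-evenCentre : (S : VSet) → receivedBound S evenCentre ≡ true
receivedBound-evenCentre S =
  allAssignments-sound 10 (λ bs → receivedBound (assign ball₂-even bs) evenCentre) refl (map S ball₂-even) refl

receivedBound-oddCentre : (S : VSet) → receivedBound S oddCentre ≡ true
receivedBound-oddCentre S =
  allAssignments-sound 10 (λ bs → receivedBound (assign ball₂-odd bs) oddCentre) refl (map S ball₂-odd) refl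

received≤21-translate : ∀ S d c → EvenShift d → receivedBound (λ v → S (translate d v)) c ≡ true →
  IsREDIC S → S (translate d c) ≡ true → received S (translate d c) ≤ 21
received≤21-translate S d c h t R p = subst (_≤ 21) (sym (received-translate S d c h))
  (receivedBound⇒received≤21 (λ v → S (translate d v)) c t p (IsREDIC⇒locallyREDIC (λ v → S (translate d v)) (IsREDIC-translate S d h R) c))

received≤21 : ∀ S w → IsREDIC S → S w ≡ true → received S w ≤ 21
received≤21 S (x , y) R p = byParity (evenV (x , y)) refl
  where
  byParity : ∀ b → evenV (x , y) ≡ b → received S (x , y) ≤ 21
  byParity true e = subst (λ v → received S v ≤ 21) centred
    (received≤21-translate S (x , y) evenCentre shift (receivedBound-evenCentre (λ v → S (translate (x , y) v))) R (subst (λ v → S v ≡ true) (sym centred) p))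
    where
    centred : translate (x , y) evenCentre ≡ (x , y)
    centred = cong₂ _,_ (ℤP.+-identityˡ x) (ℤP.+-identityˡ y)
    shift : EvenShift (x , y)
    shift = trans (sym (evenV≡evenℤ x y)) e
  byParity false e = subst (λ v → received S v ≤ 21) centred
    (received≤21-translate S (x ℤ.- + 1 , y) oddCentre shift (receivedBound-oddCentre (λ v → S (translate (x ℤ.- + 1 , y) v))) R (subst (λ v → S v ≡ true) (sym centred) p))
    where
    cancel : ∀ a → + 1 ℤ.+ (a ℤ.- + 1) ≡ a
    cancel = ℤSolver.solve-∀
    centred : translate (x ℤ.- + 1 , y) oddCentre ≡ (x , y)
    centred = cong₂ _,_ (cancel x) (ℤP.+-identityˡ y)
    shift : EvenShift (x ℤ.- + 1 , y)
    shift = trans (sym (evenV≡evenℤ (x ℤ.- + 1) y)) (trans (evenV-left (x , y)) (cong not e))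

sent : VSet → ℕ → Vertex → Vertex → ℕ
sent S r u w = bit (inBall r u) * twelveOver (nbhdCount S u) * bit (S w)

totalSent totalReceived : VSet → ℕ → Vertex → ℕ
totalSent S r u = sumL (sent S r u) (closedNbhd u)
totalReceived S r w = sumL (λ u → sent S r u w) (closedNbhd w)

sumL-*-bit : ∀ K (S : VSet) L → sumL (λ w → K * bit (S w)) L ≡ K * countB S L
sumL-*-bit K S [] = sym (ℕP.*-zeroʳ K)
sumL-*-bit K S (x ∷ L) = trans (cong (λ z → K * bit (S x) + z) (sumL-*-bit K S L))
  (trans (sym (ℕP.*-distribˡ-+ K (bit (S x)) _)) (cong (λ z → K * (z + countB S L)) (bit≡if (S x))))
  where
  bit≡if : ∀ b → bit b ≡ (if b then 1 else 0)
  bit≡if true = refl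
  bit≡if false = refl

totalSent≡12 : ∀ S r → IsREDIC S → ∀ u → totalSent S r u ≡ 12 * bit (inBall r u)
totalSent≡12 S r (dominating , _) u = begin
  totalSent S r u                       ≡⟨ sumL-*-bit (bit (inBall r u) * twelveOver c) S (closedNbhd u) ⟩
  bit (inBall r u) * twelveOver c * c   ≡⟨ ℕP.*-assoc (bit (inBall r u)) (twelveOver c) c ⟩
  bit (inBall r u) * (twelveOver c * c) ≡⟨ cong (bit (inBall r u) *_) (twelveOver-* c (dominating u) (countB≤length S (closedNbhd u))) ⟩
  bit (inBall r u) * 12                 ≡⟨ ℕP.*-comm (bit (inBall r u)) 12 ⟩
  12 * bit (inBall r u)                 ∎
  where
  open ≡-Reasoning
  c = nbhdCount S u

outside-closedNbhd : ∀ r w → inBall (suc r) w ≡ false →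
  inBall r w ≡ false × inBall r (right w) ≡ false × inBall r (left w) ≡ false × inBall r (vert w) ≡ false
outside-closedNbhd r w out rewrite nbrs≡ w =
  ∨-conicalˡ (inBall r w) _ out , ∨-conicalˡ (inBall r (right w)) _ out₁ ,
  ∨-conicalˡ (inBall r (left w)) _ out₂ , ∨-conicalˡ (inBall r (vert w)) false (∨-conicalʳ (inBall r (left w)) _ out₂)
  where
  out₁ = ∨-conicalʳ (inBall r w) _ out
  out₂ = ∨-conicalʳ (inBall r (right w)) _ out₁

totalReceived≤21 : ∀ S r → IsREDIC S → ∀ w → totalReceived S r w ≤ 21 * bit (inBall (suc r) w ∧ S w)
totalReceived≤21 S r R w = subst (_≤ 21 * bit (inBall (suc r) w ∧ S w)) (sym (sumL-*ʳ f (bit (S w)) (closedNbhd w)))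
  (bound (S w) refl)
  where
  f : Vertex → ℕ
  f u = bit (inBall r u) * twelveOver (nbhdCount S u)
  inside : ∀ b → inBall (suc r) w ≡ b → S w ≡ true → sumL f (closedNbhd w) ≤ 21 * bit b
  inside true _ Sw = ≤-trans (sumL-mono (closedNbhd w) (λ u → bit-*-≤ (inBall r u) (twelveOver (nbhdCount S u)))) (received≤21 S w R Sw)
  inside false out _ with outside-closedNbhd r w out
  ... | o , o₁ , o₂ , o₃ rewrite nbrs≡ w | o | o₁ | o₂ | o₃ = z≤n
  bound : ∀ b → S w ≡ b → sumL f (closedNbhd w) * bit b ≤ 21 * bit (inBall (suc r) w ∧ b)
  bound false _ = subst (_≤ 21 * bit (inBall (suc r) w ∧ false)) (sym (ℕP.*-zeroʳ (sumL f (closedNbhd w)))) z≤n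
  bound true e = subst₂ _≤_ (sym (ℕP.*-identityʳ _)) (cong (λ z → 21 * bit z) (sym (∧-identityʳ (inBall (suc r) w))))
    (inside (inBall (suc r) w) refl e)

left∘right : ∀ u → left (right u) ≡ u
left∘right (x , y) = cong (_, y) (cancel x)
  where
  cancel : ∀ a → (a ℤ.+ + 1) ℤ.- + 1 ≡ a
  cancel = ℤSolver.solve-∀

right∘left : ∀ u → right (left u) ≡ u
right∘left (x , y) = cong (_, y) (cancel x)
  where
  cancel : ∀ a → (a ℤ.- + 1) ℤ.+ + 1 ≡ a
  cancel = ℤSolver.solve-∀

down∘up : ∀ u → down (up u) ≡ u
down∘up (x , y) = cong (x ,_) (cancel y)
  where
  cancel : ∀ a → (a ℤ.+ + 1) ℤ.- + 1 ≡ a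
  cancel = ℤSolver.solve-∀

up∘down : ∀ u → up (down u) ≡ u
up∘down (x , y) = cong (x ,_) (cancel y)
  where
  cancel : ∀ a → (a ℤ.- + 1) ℤ.+ + 1 ≡ a
  cancel = ℤSolver.solve-∀

vstep-by-bits : ∀ (f : ℤ → ℕ) y b → f (vstep y b) ≡ bit b * f (y ℤ.+ + 1) + bit (not b) * f (y ℤ.- + 1)
vstep-by-bits f y true = sym (trans (ℕP.+-identityʳ _) (ℕP.+-identityʳ _))
vstep-by-bits f y false = sym (ℕP.+-identityʳ _)

sent-SupportedIn : ∀ S r (X : Vertex → Vertex) (k : Vertex → ℕ) → (∀ w → taxicab w ≤ suc (taxicab (X w))) →
  SupportedIn (suc r) (λ w → k w * sent S r (X w) w)
sent-SupportedIn S r X k step x y h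
  rewrite inBall-outside r (X (x , y)) (ℕP.≤-pred (≤-trans (taxicab-outside (suc r) x y h) (step (x , y)))) = ℕP.*-zeroʳ (k (x , y))

boxSum-sent-right : ∀ S r → boxSum (suc (suc r)) (λ u → sent S r u (right u)) ≡ boxSum (suc (suc r)) (λ w → sent S r (left w) w)
boxSum-sent-right S r = trans (boxSum-cong (suc (suc r)) (λ u → cong (λ z → sent S r z (right u)) (sym (left∘right u))))
  (boxSum-right (suc r) _ (SupportedIn-cong (λ w → ℕP.*-identityˡ _) (sent-SupportedIn S r left (λ _ → 1) taxicab-left)))

boxSum-sent-left : ∀ S r → boxSum (suc (suc r)) (λ u → sent S r u (left u)) ≡ boxSum (suc (suc r)) (λ w → sent S r (right w) w)
boxSum-sent-left S r = trans (boxSum-cong (suc (suc r)) (λ u → cong (λ z → sent S r z (left u)) (sym (right∘left u))))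
  (boxSum-left (suc r) _ (SupportedIn-cong (λ w → ℕP.*-identityˡ _) (sent-SupportedIn S r right (λ _ → 1) taxicab-right)))

boxSum-sent-up : ∀ S r → boxSum (suc (suc r)) (λ u → bit (evenV u) * sent S r u (up u))
                       ≡ boxSum (suc (suc r)) (λ w → bit (not (evenV w)) * sent S r (down w) w)
boxSum-sent-up S r = trans (boxSum-cong (suc (suc r)) (λ u → cong₂ (λ b z → bit b * sent S r z (up u))
                             (trans (sym (not-involutive (evenV u))) (cong not (sym (evenV-up u)))) (sym (down∘up u))))
  (boxSum-up (suc r) _ (sent-SupportedIn S r down (λ w → bit (not (evenV w))) taxicab-down))

boxSum-sent-down : ∀ S r → boxSum (suc (suc r)) (λ u → bit (not (evenV u)) * sent S r u (down u))
                         ≡ boxSum (suc (suc r)) (λ w → bit (evenV w) * sent S r (up w) w)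
boxSum-sent-down S r = trans (boxSum-cong (suc (suc r)) (λ u → cong₂ (λ b z → bit b * sent S r z (down u)) (sym (evenV-down u)) (sym (up∘down u))))
  (boxSum-down (suc r) _ (sent-SupportedIn S r up (λ w → bit (evenV w)) taxicab-up))

boxSum-+⁵ : ∀ N (a b c d e : Vertex → ℕ) →
  boxSum N (λ u → a u + (b u + (c u + (d u + e u)))) ≡ boxSum N a + (boxSum N b + (boxSum N c + (boxSum N d + boxSum N e)))
boxSum-+⁵ N a b c d e =
  trans (boxSum-+ N a (λ u → b u + (c u + (d u + e u)))) (cong (λ z → boxSum N a + z)
    (trans (boxSum-+ N b (λ u → c u + (d u + e u))) (cong (λ z → boxSum N b + z)
      (trans (boxSum-+ N c (λ u → d u + e u)) (cong (λ z → boxSum N c + z) (boxSum-+ N d e))))))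

-- Both sides sum sent S r u w over the pairs of equal or adjacent vertices;
-- the edges of each direction are matched by translating the box one step,
-- which is harmless because sent S r u w vanishes unless u ∈ B_r.
boxSum-sent≡received : ∀ S r → boxSum (suc (suc r)) (totalSent S r) ≡ boxSum (suc (suc r)) (totalReceived S r)
boxSum-sent≡received S r = begin
  boxSum N (totalSent S r)
    ≡⟨ boxSum-cong N (λ u → cong (λ z → A u + (Bʳ u + (Bˡ u + z))) (trans (ℕP.+-identityʳ _) (vstep-by-bits (λ z → sent S r u (proj₁ u , z)) (proj₂ u) (evenV u)))) ⟩
  boxSum N (λ u → A u + (Bʳ u + (Bˡ u + (Dᵘ u + Dᵈ u))))
    ≡⟨ boxSum-+⁵ N A Bʳ Bˡ Dᵘ Dᵈ ⟩
  boxSum N A + (boxSum N Bʳ + (boxSum N Bˡ + (boxSum N Dᵘ + boxSum N Dᵈ)))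
    ≡⟨ cong₂ (λ a b → boxSum N A + (a + b)) (boxSum-sent-right S r) (cong₂ _+_ (boxSum-sent-left S r) (cong₂ _+_ (boxSum-sent-up S r) (boxSum-sent-down S r))) ⟩
  boxSum N A + (boxSum N B′ˡ + (boxSum N B′ʳ + (boxSum N D′ᵈ + boxSum N D′ᵘ)))
    ≡⟨ cong (λ z → boxSum N A + z) (reorder (boxSum N B′ˡ) (boxSum N B′ʳ) (boxSum N D′ᵈ) (boxSum N D′ᵘ)) ⟩
  boxSum N A + (boxSum N B′ʳ + (boxSum N B′ˡ + (boxSum N D′ᵘ + boxSum N D′ᵈ)))
    ≡⟨ sym (boxSum-+⁵ N A B′ʳ B′ˡ D′ᵘ D′ᵈ) ⟩
  boxSum N (λ w → A w + (B′ʳ w + (B′ˡ w + (D′ᵘ w + D′ᵈ w))))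
    ≡⟨ boxSum-cong N (λ w → cong (λ z → A w + (B′ʳ w + (B′ˡ w + z))) (sym (trans (ℕP.+-identityʳ _) (vstep-by-bits (λ z → sent S r (proj₁ w , z) w) (proj₂ w) (evenV w))))) ⟩
  boxSum N (totalReceived S r) ∎
  where
  open ≡-Reasoning
  N = suc (suc r)
  A Bʳ Bˡ Dᵘ Dᵈ B′ʳ B′ˡ D′ᵘ D′ᵈ : Vertex → ℕ
  A u = sent S r u u
  Bʳ u = sent S r u (right u)
  Bˡ u = sent S r u (left u)
  Dᵘ u = bit (evenV u) * sent S r u (up u)
  Dᵈ u = bit (not (evenV u)) * sent S r u (down u)
  B′ʳ w = sent S r (right w) w
  B′ˡ w = sent S r (left w) w
  D′ᵘ w = bit (evenV w) * sent S r (up w) w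
  D′ᵈ w = bit (not (evenV w)) * sent S r (down w) w
  reorder : ∀ a b c d → a + (b + (c + d)) ≡ b + (a + (d + c))
  reorder = ℕSolver.solve-∀

discharging : ∀ S r → IsREDIC S → 12 * ballSize r ≤ 21 * ballCount S (suc r)
discharging S r R = begin
  12 * ballSize r                                      ≡⟨ cong (12 *_) (ballSize≡boxSum r 2) ⟩
  12 * boxSum N (λ v → bit (inBall r v))               ≡⟨ sym (boxSum-* N 12 (λ v → bit (inBall r v))) ⟩
  boxSum N (λ v → 12 * bit (inBall r v))               ≡⟨ sym (boxSum-cong N (totalSent≡12 S r R)) ⟩
  boxSum N (totalSent S r)                             ≡⟨ boxSum-sent≡received S r ⟩
  boxSum N (totalReceived S r)                         ≤⟨ boxSum-mono N (totalReceived≤21 S r R) ⟩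
  boxSum N (λ w → 21 * bit (inBall (suc r) w ∧ S w))   ≡⟨ boxSum-* N 21 (λ w → bit (inBall (suc r) w ∧ S w)) ⟩
  21 * boxSum N (λ w → bit (inBall (suc r) w ∧ S w))   ≡⟨ cong (21 *_) (sym (ballCount≡boxSum S (suc r) 1)) ⟩
  21 * ballCount S (suc r)                             ∎
  where
  open ℕP.≤-Reasoning
  N = suc (suc r)

-- Growth of the balls

vdist-above : ∀ i e → suc (vdist (+ i) e) ≤ vdist (+ suc i) (not e)
vdist-above i true = ≤-refl
vdist-above zero false = ≤-refl
vdist-above (suc i) false = s≤s (s≤s (≤-trans (n≤1+n _) (n≤1+n _)))

vdist-below : ∀ m e → suc (vdist (-[1+ m ] ℤ.+ + 1) (not e)) ≤ vdist -[1+ m ] e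
vdist-below zero true = ≤-refl
vdist-below zero false = s≤s z≤n
vdist-below (suc m) true = ≤-refl
vdist-below (suc m) false = s≤s (s≤s (s≤s (≤-trans (n≤1+n _) (n≤1+n _))))

vdist-≤ : ∀ b e → vdist (+ b) e ≤ suc (double b)
vdist-≤ b true = n≤1+n _
vdist-≤ zero false = ≤-refl
vdist-≤ (suc b) false = s≤s (≤-trans (n≤1+n _) (s≤s (n≤1+n _)))

+suc≡ : ∀ n → + n ℤ.+ + 1 ≡ + suc n
+suc≡ n = cong +_ (+-comm n 1)

inBall-shrink-above : ∀ r x i → inBall (suc r) (x , + suc i) ≡ true → inBall r (x , + i) ≡ true
inBall-shrink-above r x i p with inBall⇒bounded (suc r) (x , + suc i) p
... | (a , b) = bounded⇒inBall r (x , + i) (ℕP.≤-pred (subst (_≤ suc r) (+-suc ∣ x ∣ i) a))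
  (ℕP.≤-pred (≤-trans (subst (λ e → suc (vdist (+ i) (evenV (x , + i))) ≤ vdist (+ suc i) e) (sym parity) (vdist-above i (evenV (x , + i)))) b))
  where
  parity : evenV (x , + suc i) ≡ not (evenV (x , + i))
  parity = trans (cong (λ z → evenV (x , z)) (sym (+suc≡ i))) (evenV-up (x , + i))

inBall-shrink-below : ∀ r x m → inBall (suc r) (x , -[1+ m ]) ≡ true → inBall r (x , -[1+ m ] ℤ.+ + 1) ≡ true
inBall-shrink-below r x m p with inBall⇒bounded (suc r) (x , -[1+ m ]) p
... | (a , b) = bounded⇒inBall r (x , -[1+ m ] ℤ.+ + 1)
  (ℕP.≤-pred (≤-trans (ℕP.≤-reflexive (sym (+-suc ∣ x ∣ _))) (≤-trans (ℕP.+-monoʳ-≤ ∣ x ∣ (∣-[1+]+1∣ m)) a)))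
  (ℕP.≤-pred (≤-trans (subst (λ e → suc (vdist (-[1+ m ] ℤ.+ + 1) e) ≤ vdist -[1+ m ] (evenV (x , -[1+ m ])))
    (sym (evenV-up (x , -[1+ m ]))) (vdist-below m (evenV (x , -[1+ m ])))) b))
  where
  ∣-[1+]+1∣ : ∀ m → suc ∣ -[1+ m ] ℤ.+ + 1 ∣ ≤ suc m
  ∣-[1+]+1∣ zero = s≤s z≤n
  ∣-[1+]+1∣ (suc m) = ≤-refl

∑-shiftˡ-≤ : ∀ m (F G : ℕ → ℕ) → (∀ i → F i ≤ 1) → (∀ i → F (suc i) ≤ G i) → ∑ (suc m) F ≤ 1 + ∑ (suc m) G
∑-shiftˡ-≤ m F G F≤1 FG = +-mono-≤ (F≤1 0)
  (≤-trans (∑-mono m (λ i _ → FG i)) (subst (∑ m G ≤_) (sym (∑-last m G)) (ℕP.m≤m+n _ _)))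

∑-shiftʳ-≤ : ∀ m (F G : ℕ → ℕ) → (∀ i → F i ≤ 1) → (∀ i → suc i < m → F i ≤ G (suc i)) → ∑ m F ≤ 1 + ∑ m G
∑-shiftʳ-≤ zero F G F≤1 FG = z≤n
∑-shiftʳ-≤ (suc m) F G F≤1 FG = subst (_≤ 1 + ∑ (suc m) G) (sym (∑-last m F))
  (subst (∑ m F + F m ≤_) (+-comm (∑ (suc m) G) 1)
    (+-mono-≤ (≤-trans (∑-mono m {F} {λ i → G (suc i)} (λ i lt → FG i (s≤s lt))) (ℕP.m≤n+m _ (G 0))) (F≤1 m)))

column-growth : ∀ r x → ∑ (width (suc r)) (λ j → bit (inBall (suc r) (x , coord (suc r) j)))
                      ≤ 2 + ∑ (width (suc r)) (λ j → bit (inBall r (x , coord (suc r) j)))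
column-growth r x = begin
  ∑ (width N) f                                     ≡⟨ cong (λ k → ∑ k f) width≡ ⟩
  ∑ (N + suc N) f                                   ≡⟨ ∑-+-range N (suc N) f ⟩
  ∑ N f + ∑ (suc N) (λ i → f (N + i))               ≤⟨ +-mono-≤ below above ⟩
  (1 + ∑ N g) + (1 + ∑ (suc N) (λ i → g (N + i)))   ≡⟨ cong suc (+-suc _ _) ⟩
  2 + (∑ N g + ∑ (suc N) (λ i → g (N + i)))         ≡⟨ cong (λ z → 2 + z) (sym (∑-+-range N (suc N) g)) ⟩
  2 + ∑ (N + suc N) g                               ≡⟨ cong (λ k → 2 + ∑ k g) (sym width≡) ⟩
  2 + ∑ (width N) g                                 ∎
  where
  open ℕP.≤-Reasoning
  N = suc r
  f g : ℕ → ℕ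
  f j = bit (inBall (suc r) (x , coord N j))
  g j = bit (inBall r (x , coord N j))
  width≡ : width N ≡ N + suc N
  width≡ = sym (+-suc N N)
  above : ∑ (suc N) (λ i → f (N + i)) ≤ 1 + ∑ (suc N) (λ i → g (N + i))
  above = ∑-shiftˡ-≤ N (λ i → f (N + i)) (λ i → g (N + i)) (λ i → bit≤1 _)
    (λ i → subst₂ (λ a b → bit (inBall (suc r) (x , a)) ≤ bit (inBall r (x , b))) (sym (coord-+ N (suc i))) (sym (coord-+ N i))
       (bit-mono (inBall-shrink-above r x i)))
  below : ∑ N f ≤ 1 + ∑ N g
  below = ∑-shiftʳ-≤ N f g (λ i → bit≤1 _) step
    where
    step : ∀ i → suc i < N → f i ≤ g (suc i)
    step i lt with coord-negative N i (ℕP.<-trans (ℕP.n<1+n i) lt)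
    ... | (k , eq) = subst₂ (λ a b → bit (inBall (suc r) (x , a)) ≤ bit (inBall r (x , b))) (sym eq)
                       (trans (cong (ℤ._+ + 1) (sym eq)) (coord-+1 N i)) (bit-mono (inBall-shrink-below r x k))

ballSize-suc-≤ : ∀ r → ballSize (suc r) ≤ width (suc r) * 2 + ballSize r
ballSize-suc-≤ r = begin
  ballSize (suc r)                                   ≡⟨ ballSize≡boxSum (suc r) 0 ⟩
  ∑ (width N) (column N f)                           ≤⟨ ∑-mono (width N) (λ i _ → column-growth r (coord N i)) ⟩
  ∑ (width N) (λ i → 2 + column N g i)               ≡⟨ ∑-+ (width N) (λ _ → 2) (column N g) ⟩
  ∑ (width N) (λ _ → 2) + boxSum N g                 ≡⟨ cong₂ _+_ (∑-const (width N) 2) (sym (ballSize≡boxSum r 1)) ⟩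
  width N * 2 + ballSize r                           ∎
  where
  open ℕP.≤-Reasoning
  N = suc r
  f g : Vertex → ℕ
  f v = bit (inBall (suc r) v)
  g v = bit (inBall r v)

∑-upper-part≤ : ∀ r h (f : ℕ → ℕ) → h ≤ r → ∑ (suc h) (λ b → f (r + b)) ≤ ∑ (width r) f
∑-upper-part≤ r h f h≤r = begin
  ∑ (suc h) (λ b → f (r + b))                ≤⟨ ∑-mono-range (λ b → f (r + b)) (s≤s h≤r) ⟩
  ∑ (suc r) (λ b → f (r + b))                ≤⟨ ℕP.m≤n+m _ (∑ r f) ⟩
  ∑ r f + ∑ (suc r) (λ b → f (r + b))        ≡⟨ sym (∑-+-range r (suc r) f) ⟩
  ∑ (r + suc r) f                            ≡⟨ cong (λ k → ∑ k f) (+-suc r r) ⟩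
  ∑ (width r) f                              ∎
  where open ℕP.≤-Reasoning

inBall-square : ∀ r h a b → a ≤ h → b ≤ h → suc (double h) ≤ r → inBall r (+ a , + b) ≡ true
inBall-square r h a b a≤h b≤h 2h<r = bounded⇒inBall r (+ a , + b)
  (≤-trans (+-mono-≤ a≤h b≤h) (≤-trans (ℕP.≤-reflexive (sym (double≡+ h))) (≤-trans (n≤1+n _) 2h<r)))
  (≤-trans (vdist-≤ b (evenV (+ a , + b))) (≤-trans (s≤s (double-mono b≤h)) 2h<r))

square≤ballSize : ∀ r h → suc (double h) ≤ r → suc h * suc h ≤ ballSize r
square≤ballSize r h 2h<r = begin
  suc h * suc h                               ≤⟨ ∑-lower (suc h) (suc h) (λ a a≤h → row a (ℕP.≤-pred a≤h)) ⟩
  ∑ (suc h) (λ a → column r F (r + a))        ≤⟨ ∑-upper-part≤ r h (column r F) h≤r ⟩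
  boxSum r F                                  ≡⟨ sym (ballSize≡boxSum r 0) ⟩
  ballSize r                                  ∎
  where
  open ℕP.≤-Reasoning
  F : Vertex → ℕ
  F v = bit (inBall r v)
  h≤r : h ≤ r
  h≤r = ≤-trans (≤-trans (n≤double h) (n≤1+n _)) 2h<r
  inside : ∀ a b → a ≤ h → b ≤ h → 1 ≤ F (coord r (r + a) , coord r (r + b))
  inside a b a≤h b≤h = ℕP.≤-reflexive (sym (cong bit
    (trans (cong₂ (λ u v → inBall r (u , v)) (coord-+ r a) (coord-+ r b)) (inBall-square r h a b a≤h b≤h 2h<r))))
  row : ∀ a → a ≤ h → suc h ≤ column r F (r + a)
  row a a≤h = begin
    suc h                                                    ≡⟨ sym (ℕP.*-identityʳ (suc h)) ⟩
    suc h * 1                                                ≤⟨ ∑-lower (suc h) 1 (λ b b≤h → inside a b a≤h (ℕP.≤-pred b≤h)) ⟩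
    ∑ (suc h) (λ b → F (coord r (r + a) , coord r (r + b)))  ≤⟨ ∑-upper-part≤ r h (λ j → F (coord r (r + a) , coord r j)) h≤r ⟩
    column r F (r + a)                                       ∎

-- The lower bound

IsREDIC-ballCount-lower : ∀ S → IsREDIC S → ∀ r → 4 * ballSize (suc r) ≤ 7 * ballCount S (suc r) + 8 * width (suc r)
IsREDIC-ballCount-lower S R r = begin
  4 * ballSize (suc r)                              ≤⟨ *-monoʳ-≤ 4 (ballSize-suc-≤ r) ⟩
  4 * (width (suc r) * 2 + ballSize r)              ≡⟨ distribute (width (suc r)) (ballSize r) ⟩
  4 * ballSize r + 8 * width (suc r)                ≤⟨ +-mono-≤ discharged ≤-refl ⟩
  7 * ballCount S (suc r) + 8 * width (suc r)       ∎
  where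
  open ℕP.≤-Reasoning
  distribute : ∀ w b → 4 * (w * 2 + b) ≡ 4 * b + 8 * w
  distribute = ℕSolver.solve-∀
  discharged : 4 * ballSize r ≤ 7 * ballCount S (suc r)
  discharged = ℕP.*-cancelˡ-≤ 3 (subst₂ _≤_ (ℕP.*-assoc 3 4 (ballSize r)) (ℕP.*-assoc 3 7 (ballCount S (suc r))) (discharging S r R))

width-double : ∀ h → width (suc (double h)) ≡ 3 + 4 * h
width-double h = trans (cong (λ z → suc (suc z + suc z)) (double≡+ h)) (expand h)
  where
  expand : ∀ h → suc (suc (h + h) + suc (h + h)) ≡ 3 + 4 * h
  expand = ℕSolver.solve-∀

lower-boundary-negligible : ∀ K h → 5 * K ≤ h → K * (8 * width (suc (double h))) ≤ 7 * ballSize (suc (double h))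
lower-boundary-negligible K h 5K≤h = begin
  K * (8 * width (suc (double h)))     ≡⟨ cong (λ z → K * (8 * z)) (width-double h) ⟩
  K * (8 * (3 + 4 * h))                ≤⟨ ℕP.m≤m+n _ (8 * K) ⟩
  K * (8 * (3 + 4 * h)) + 8 * K        ≡⟨ regroup K h ⟩
  (32 * K) * suc h                     ≤⟨ *-monoˡ-≤ (suc h) 32K≤7[1+h] ⟩
  (7 * suc h) * suc h                  ≡⟨ ℕP.*-assoc 7 (suc h) (suc h) ⟩
  7 * (suc h * suc h)                  ≤⟨ *-monoʳ-≤ 7 (square≤ballSize (suc (double h)) h ≤-refl) ⟩
  7 * ballSize (suc (double h))        ∎
  where
  open ℕP.≤-Reasoning
  regroup : ∀ K h → K * (8 * (3 + 4 * h)) + 8 * K ≡ (32 * K) * suc h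
  regroup = ℕSolver.solve-∀
  32K≤7[1+h] : 32 * K ≤ 7 * suc h
  32K≤7[1+h] = ≤-trans (ℕP.m≤m+n (32 * K) (3 * K + 7)) (≤-trans (ℕP.≤-reflexive (expand K)) (*-monoʳ-≤ 7 (s≤s 5K≤h)))
    where
    expand : ∀ K → 32 * K + (3 * K + 7) ≡ 7 * suc (5 * K)
    expand = ℕSolver.solve-∀

REDIC-density≥4/7 : REDICDensityLowerBound 4 7
REDIC-density≥4/7 S R k R₀ = r , R₀≤r , bound
  where
  K = suc k
  h = 5 * K + R₀
  r = suc (double h)
  R₀≤r : R₀ ≤ r
  R₀≤r = ≤-trans (ℕP.m≤n+m R₀ (5 * K)) (≤-trans (n≤double h) (n≤1+n _))
  bound : 4 * K * ballSize r ≤ 7 * K * ballCount S r + 7 * ballSize r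
  bound = begin
    4 * K * ballSize r                                          ≡⟨ commute K (ballSize r) ⟩
    4 * ballSize r * K                                          ≤⟨ *-monoˡ-≤ K (IsREDIC-ballCount-lower S R (double h)) ⟩
    (7 * ballCount S r + 8 * width r) * K                       ≡⟨ distribute K (ballCount S r) (width r) ⟩
    7 * K * ballCount S r + K * (8 * width r)                   ≤⟨ +-mono-≤ (≤-refl {7 * K * ballCount S r}) (lower-boundary-negligible K h (ℕP.m≤m+n _ _)) ⟩
    7 * K * ballCount S r + 7 * ballSize r                      ∎
    where
    open ℕP.≤-Reasoning
    commute : ∀ K b → 4 * K * b ≡ 4 * b * K
    commute = ℕSolver.solve-∀
    distribute : ∀ K c w → (7 * c + 8 * w) * K ≡ 7 * K * c + K * (8 * w)
    distribute = ℕSolver.solve-∀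

-- A periodic RED:IC of density 2/3

mod6 : ℤ → ℕ
mod6 (+ n) = n % 6
mod6 -[1+ n ] = 5 ∸ (n % 6)

mod6<6 : ∀ z → mod6 z < 6
mod6<6 (+ n) = DM.m%n<n n 6
mod6<6 -[1+ n ] = s≤s (ℕP.m∸n≤m 5 (n % 6))

suc-%6 : ∀ n → suc n % 6 ≡ suc (n % 6) % 6
suc-%6 n = DM.%-distribˡ-+ 1 n 6

mod6-suc : ∀ z → mod6 (z ℤ.+ + 1) ≡ suc (mod6 z) % 6
mod6-suc (+ n) rewrite +-comm n 1 = suc-%6 n
mod6-suc -[1+ zero ] = refl
mod6-suc -[1+ suc n ] rewrite suc-%6 n = reflect (n % 6) (DM.m%n<n n 6)
  where
  reflect : ∀ a → a < 6 → 5 ∸ a ≡ suc (5 ∸ (suc a % 6)) % 6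
  reflect 0 _ = refl
  reflect 1 _ = refl
  reflect 2 _ = refl
  reflect 3 _ = refl
  reflect 4 _ = refl
  reflect 5 _ = refl
  reflect (suc (suc (suc (suc (suc (suc a)))))) (s≤s (s≤s (s≤s (s≤s (s≤s (s≤s ()))))))

mod6-+ : ∀ z k → mod6 (z ℤ.+ + k) ≡ (mod6 z + k) % 6
mod6-+ z zero rewrite ℤP.+-identityʳ z | ℕP.+-identityʳ (mod6 z) = sym (DM.m<n⇒m%n≡m (mod6<6 z))
mod6-+ z (suc k) = begin
  mod6 (z ℤ.+ + suc k)               ≡⟨ cong mod6 (trans (cong (λ n → z ℤ.+ n) (ℤP.pos-+ 1 k)) (shift z (+ k))) ⟩
  mod6 ((z ℤ.+ + k) ℤ.+ + 1)         ≡⟨ mod6-suc (z ℤ.+ + k) ⟩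
  suc (mod6 (z ℤ.+ + k)) % 6         ≡⟨ cong (λ n → suc n % 6) (mod6-+ z k) ⟩
  suc ((mod6 z + k) % 6) % 6         ≡⟨ sym (suc-%6 (mod6 z + k)) ⟩
  suc (mod6 z + k) % 6               ≡⟨ cong (_% 6) (sym (+-suc (mod6 z) k)) ⟩
  (mod6 z + suc k) % 6               ∎
  where
  open ≡-Reasoning
  shift : ∀ a b → a ℤ.+ (+ 1 ℤ.+ b) ≡ (a ℤ.+ b) ℤ.+ + 1
  shift = ℤSolver.solve-∀

MultipleOf6 : ℤ → Set
MultipleOf6 z = Σ ℕ λ k → (z ≡ + (k * 6)) ⊎ (z ≡ ℤ.- (+ (k * 6)))

mod6-+-MultipleOf6 : ∀ a z → MultipleOf6 z → mod6 (a ℤ.+ z) ≡ mod6 a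
mod6-+-MultipleOf6 a z (k , inj₁ refl) = trans (mod6-+ a (k * 6)) (trans (DM.[m+kn]%n≡m%n (mod6 a) k 6) (DM.m<n⇒m%n≡m (mod6<6 a)))
mod6-+-MultipleOf6 a z (k , inj₂ refl) =
  sym (trans (cong mod6 (sym (cancel a (+ (k * 6))))) (mod6-+-MultipleOf6 (a ℤ.+ ℤ.- (+ (k * 6))) _ (k , inj₁ refl)))
  where
  cancel : ∀ a b → (a ℤ.+ ℤ.- b) ℤ.+ b ≡ a
  cancel = ℤSolver.solve-∀

minus-mod6-MultipleOf6 : ∀ x → MultipleOf6 (x ℤ.- + mod6 x)
minus-mod6-MultipleOf6 (+ n) = n / 6 , inj₁ (begin
  + n ℤ.- + (n % 6)                              ≡⟨ cong (λ m → + m ℤ.- + (n % 6)) (DM.m≡m%n+[m/n]*n n 6) ⟩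
  + (n % 6 + n / 6 * 6) ℤ.- + (n % 6)            ≡⟨ cong (ℤ._- + (n % 6)) (ℤP.pos-+ (n % 6) (n / 6 * 6)) ⟩
  (+ (n % 6) ℤ.+ + (n / 6 * 6)) ℤ.- + (n % 6)    ≡⟨ cancel (+ (n % 6)) (+ (n / 6 * 6)) ⟩
  + (n / 6 * 6)                                  ∎)
  where
  open ≡-Reasoning
  cancel : ∀ a b → (a ℤ.+ b) ℤ.- a ≡ b
  cancel = ℤSolver.solve-∀
minus-mod6-MultipleOf6 -[1+ n ] = suc q , inj₂ (begin
  -[1+ n ] ℤ.- + (5 ∸ a)                                   ≡⟨ cong₂ ℤ._-_ split-n 5∸a ⟩
  ℤ.- (+ 1 ℤ.+ (+ a ℤ.+ + (q * 6))) ℤ.- (+ 5 ℤ.- + a)       ≡⟨ regroup (+ a) (+ (q * 6)) ⟩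
  ℤ.- (+ 6 ℤ.+ + (q * 6))                                  ≡⟨ cong ℤ.-_ (sym (ℤP.pos-+ 6 (q * 6))) ⟩
  ℤ.- (+ (suc q * 6))                                      ∎)
  where
  open ≡-Reasoning
  a = n % 6
  q = n / 6
  split-n : -[1+ n ] ≡ ℤ.- (+ 1 ℤ.+ (+ a ℤ.+ + (q * 6)))
  split-n = trans (cong (λ m → ℤ.- (+ suc m)) (DM.m≡m%n+[m/n]*n n 6))
                  (cong ℤ.-_ (trans (ℤP.pos-+ 1 (a + q * 6)) (cong (λ t → + 1 ℤ.+ t) (ℤP.pos-+ a (q * 6)))))
  5∸a : + (5 ∸ a) ≡ + 5 ℤ.- + a
  5∸a = sym (trans (ℤP.m-n≡m⊖n 5 a) (ℤP.⊖-≥ (ℕP.≤-pred (DM.m%n<n n 6))))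
  regroup : ∀ A Q → ℤ.- (+ 1 ℤ.+ (A ℤ.+ Q)) ℤ.- (+ 5 ℤ.- A) ≡ ℤ.- (+ 6 ℤ.+ Q)
  regroup = ℤSolver.solve-∀

even-*6 : ∀ k → even (k * 6) ≡ true
even-*6 zero = refl
even-*6 (suc k) = even-*6 k

evenℤ-MultipleOf6 : ∀ z → MultipleOf6 z → evenℤ z ≡ true
evenℤ-MultipleOf6 z (k , inj₁ refl) = even-*6 k
evenℤ-MultipleOf6 z (k , inj₂ refl) = trans (cong even (ℤP.∣-i∣≡∣i∣ (+ (k * 6)))) (even-*6 k)

excluded : ℕ → ℕ
excluded 0 = 2
excluded 1 = 2
excluded 2 = 1
excluded 3 = 1
excluded _ = 0

inCodeMod6 : ℕ → ℕ → Bool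
inCodeMod6 a b = not ((b % 3) ≡ᵇ excluded a)

code : VSet
code (x , y) = inCodeMod6 (mod6 x) (mod6 y)

periodShift : Vertex → Vertex
periodShift (x , y) = (x ℤ.- + mod6 x , y ℤ.- + mod6 y)

representative : Vertex → Vertex
representative (x , y) = (+ mod6 x , + mod6 y)

periodShift-even : ∀ u → EvenShift (periodShift u)
periodShift-even (x , y) = trans (evenℤ-+ (x ℤ.- + mod6 x) (y ℤ.- + mod6 y))
  (cong₂ xnor (evenℤ-MultipleOf6 _ (minus-mod6-MultipleOf6 y)) (evenℤ-MultipleOf6 _ (minus-mod6-MultipleOf6 x)))

translate-representative : ∀ u → translate (periodShift u) (representative u) ≡ u
translate-representative (x , y) = cong₂ _,_ (cancel (+ mod6 x) x) (cancel (+ mod6 y) y)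
  where
  cancel : ∀ a b → a ℤ.+ (b ℤ.- a) ≡ b
  cancel = ℤSolver.solve-∀

code-periodic : ∀ u v → code (translate (periodShift u) v) ≡ code v
code-periodic (x , y) (a , b) =
  cong₂ inCodeMod6 (mod6-+-MultipleOf6 a _ (minus-mod6-MultipleOf6 x)) (mod6-+-MultipleOf6 b _ (minus-mod6-MultipleOf6 y))

symDiffCount-cong : ∀ {S S′ : VSet} u v → (∀ w → S w ≡ S′ w) → symDiffCount S u v ≡ symDiffCount S′ u v
symDiffCount-cong u v h =
  cong₂ _+_ (countB-cong (closedNbhd u) (λ w → cong (λ b → b ∧ not (elemV w (closedNbhd v))) (h w)))
            (countB-cong (closedNbhd v) (λ w → cong (λ b → b ∧ not (elemV w (closedNbhd u))) (h w)))

all<6 : (ℕ → Bool) → Bool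
all<6 f = f 0 ∧ (f 1 ∧ (f 2 ∧ (f 3 ∧ (f 4 ∧ f 5))))

all<6-sound : ∀ f → all<6 f ≡ true → ∀ a → a < 6 → f a ≡ true
all<6-sound f h 0 _ = ∧-conicalˡ _ _ h
all<6-sound f h 1 _ = ∧-conicalˡ _ _ (∧-conicalʳ (f 0) _ h)
all<6-sound f h 2 _ = ∧-conicalˡ _ _ (∧-conicalʳ (f 1) _ (∧-conicalʳ (f 0) _ h))
all<6-sound f h 3 _ = ∧-conicalˡ _ _ (∧-conicalʳ (f 2) _ (∧-conicalʳ (f 1) _ (∧-conicalʳ (f 0) _ h)))
all<6-sound f h 4 _ = ∧-conicalˡ _ _ (∧-conicalʳ (f 3) _ (∧-conicalʳ (f 2) _ (∧-conicalʳ (f 1) _ (∧-conicalʳ (f 0) _ h))))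
all<6-sound f h 5 _ = ∧-conicalʳ (f 4) _ (∧-conicalʳ (f 3) _ (∧-conicalʳ (f 2) _ (∧-conicalʳ (f 1) _ (∧-conicalʳ (f 0) _ h))))
all<6-sound f h (suc (suc (suc (suc (suc (suc a)))))) (s≤s (s≤s (s≤s (s≤s (s≤s (s≤s ()))))))

all<6² : (ℕ → ℕ → Bool) → Bool
all<6² f = all<6 (λ a → all<6 (f a))

all<6²-mod6 : ∀ f → all<6² f ≡ true → ∀ x y → f (mod6 x) (mod6 y) ≡ true
all<6²-mod6 f h x y = all<6-sound (f (mod6 x)) (all<6-sound (λ a → all<6 (f a)) h (mod6 x) (mod6<6 x)) (mod6 y) (mod6<6 y)

allOffsets : (ℤ → Bool) → Bool
allOffsets f = f (+ 0) ∧ (f (+ 1) ∧ (f (+ 2) ∧ (f -[1+ 0 ] ∧ (f -[1+ 1 ] ∧ true))))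

allOffsets-sound : ∀ f → allOffsets f ≡ true → ∀ z → ∣ z ∣ ≤ 2 → f z ≡ true
allOffsets-sound f h (+ 0) _ = ∧-conicalˡ _ _ h
allOffsets-sound f h (+ 1) _ = ∧-conicalˡ _ _ (∧-conicalʳ (f (+ 0)) _ h)
allOffsets-sound f h (+ 2) _ = ∧-conicalˡ _ _ (∧-conicalʳ (f (+ 1)) _ (∧-conicalʳ (f (+ 0)) _ h))
allOffsets-sound f h -[1+ 0 ] _ = ∧-conicalˡ _ _ (∧-conicalʳ (f (+ 2)) _ (∧-conicalʳ (f (+ 1)) _ (∧-conicalʳ (f (+ 0)) _ h)))
allOffsets-sound f h -[1+ 1 ] _ =
  ∧-conicalˡ _ _ (∧-conicalʳ (f -[1+ 0 ]) _ (∧-conicalʳ (f (+ 2)) _ (∧-conicalʳ (f (+ 1)) _ (∧-conicalʳ (f (+ 0)) _ h))))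
allOffsets-sound f h (+ suc (suc (suc n))) (s≤s (s≤s ()))
allOffsets-sound f h -[1+ suc (suc n) ] (s≤s (s≤s ()))

nbhdCount-code-representative : ∀ u → nbhdCount code u ≡ nbhdCount code (representative u)
nbhdCount-code-representative u = begin
  nbhdCount code u                                                    ≡⟨ cong (nbhdCount code) (sym (translate-representative u)) ⟩
  nbhdCount code (translate (periodShift u) (representative u))       ≡⟨ nbhdCount-translate code (periodShift u) (representative u) (periodShift-even u) ⟩
  nbhdCount (λ v → code (translate (periodShift u) v)) (representative u) ≡⟨ countB-cong (closedNbhd (representative u)) (code-periodic u) ⟩
  nbhdCount code (representative u)                                   ∎
  where open ≡-Reasoning

code-dominating : ∀ v → 2 ≤ nbhdCount code v
code-dominating (x , y) = subst (2 ≤_) (sym (nbhdCount-code-representative (x , y)))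
  (≤ᵇ⇒≤ 2 _ (all<6²-mod6 (λ a b → 2 ≤ᵇ nbhdCount code (+ a , + b)) refl x y))

Within : ℕ → Vertex → Vertex → Set
Within k (x , y) (x′ , y′) = ∣ x′ ℤ.- x ∣ ≤ k × ∣ y′ ℤ.- y ∣ ≤ k

∣i-i∣≤1 : ∀ a → ∣ a ℤ.- a ∣ ≤ 1
∣i-i∣≤1 a rewrite ℤP.+-inverseʳ a = z≤n

∣[i+1]-i∣≤1 : ∀ a → ∣ (a ℤ.+ + 1) ℤ.- a ∣ ≤ 1
∣[i+1]-i∣≤1 a = subst (λ z → ∣ z ∣ ≤ 1) (sym (cancel a)) ≤-refl
  where
  cancel : ∀ a → (a ℤ.+ + 1) ℤ.- a ≡ + 1
  cancel = ℤSolver.solve-∀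

∣[i-1]-i∣≤1 : ∀ a → ∣ (a ℤ.- + 1) ℤ.- a ∣ ≤ 1
∣[i-1]-i∣≤1 a = subst (λ z → ∣ z ∣ ≤ 1) (sym (cancel a)) ≤-refl
  where
  cancel : ∀ a → (a ℤ.- + 1) ℤ.- a ≡ ℤ.- + 1
  cancel = ℤSolver.solve-∀

closedNbhd-Within1 : ∀ u w → w ∈ closedNbhd u → Within 1 u w
closedNbhd-Within1 (x , y) _ (here refl) = ∣i-i∣≤1 x , ∣i-i∣≤1 y
closedNbhd-Within1 (x , y) _ (there (here refl)) = ∣[i+1]-i∣≤1 x , ∣i-i∣≤1 y
closedNbhd-Within1 (x , y) _ (there (there (here refl))) = ∣[i-1]-i∣≤1 x , ∣i-i∣≤1 y
closedNbhd-Within1 (x , y) _ (there (there (there (here refl)))) = ∣i-i∣≤1 x , vstep-near (evenV (x , y))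
  where
  vstep-near : ∀ e → ∣ vstep y e ℤ.- y ∣ ≤ 1
  vstep-near true = ∣[i+1]-i∣≤1 y
  vstep-near false = ∣[i-1]-i∣≤1 y

∣i-k∣≤∣i-j∣+∣j-k∣ : ∀ i j k → ∣ i ℤ.- k ∣ ≤ ∣ i ℤ.- j ∣ + ∣ j ℤ.- k ∣
∣i-k∣≤∣i-j∣+∣j-k∣ i j k = subst (λ z → ∣ z ∣ ≤ ∣ i ℤ.- j ∣ + ∣ j ℤ.- k ∣) (telescope i j k) (ℤP.∣i+j∣≤∣i∣+∣j∣ (i ℤ.- j) (j ℤ.- k))
  where
  telescope : ∀ a b c → (a ℤ.- b) ℤ.+ (b ℤ.- c) ≡ a ℤ.- c
  telescope = ℤSolver.solve-∀

Within-common : ∀ {a b} u v w → Within a u w → Within b v w → Within (b + a) u v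
Within-common (x , y) (x′ , y′) (x″ , y″) (wx , wy) (vx , vy) =
  ≤-trans (∣i-k∣≤∣i-j∣+∣j-k∣ x′ x″ x) (+-mono-≤ (subst (_≤ _) (ℤP.∣i-j∣≡∣j-i∣ x″ x′) vx) wx) ,
  ≤-trans (∣i-k∣≤∣i-j∣+∣j-k∣ y′ y″ y) (+-mono-≤ (subst (_≤ _) (ℤP.∣i-j∣≡∣j-i∣ y″ y′) vy) wy)

countB-cong-∈ : ∀ {p q} L → (∀ v → v ∈ L → p v ≡ q v) → countB p L ≡ countB q L
countB-cong-∈ [] h = refl
countB-cong-∈ (x ∷ L) h = cong₂ (λ b n → (if b then 1 else 0) + n) (h x (here refl)) (countB-cong-∈ L (λ v v∈L → h v (there v∈L)))

elemV-false : ∀ w L → (∀ z → z ∈ L → eqV w z ≡ false) → elemV w L ≡ false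
elemV-false w [] h = refl
elemV-false w (z ∷ L) h rewrite h z (here refl) = elemV-false w L (λ z′ z′∈L → h z′ (there z′∈L))

-- Far apart vertices have disjoint closed neighbourhoods, so their symmetric
-- difference contains N[u] ∩ S.
exclusiveCount-far : ∀ (S : VSet) u v → ¬ Within 2 u v →
  countB (λ w → S w ∧ not (elemV w (closedNbhd v))) (closedNbhd u) ≡ nbhdCount S u
exclusiveCount-far S u v far = countB-cong-∈ (closedNbhd u) outside-v
  where
  meet : ∀ w z → w ∈ closedNbhd u → z ∈ closedNbhd v → eqV w z ≡ true → Within 2 u v
  meet w z w∈ z∈ w≡z with eqV⇒≡ w z w≡z
  ... | refl = Within-common u v w (closedNbhd-Within1 u w w∈) (closedNbhd-Within1 v w z∈)
  outside-v : ∀ w → w ∈ closedNbhd u → S w ∧ not (elemV w (closedNbhd v)) ≡ S w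
  outside-v w w∈ rewrite elemV-false w (closedNbhd v) (λ z z∈ → ¬-not (λ w≡z → far (meet w z w∈ z∈ w≡z))) = ∧-identityʳ (S w)

separatedByCode : Vertex → Vertex → Bool
separatedByCode u w = eqV u w ∨ (2 ≤ᵇ symDiffCount code u w)

code-separating-near : ∀ u v → Within 2 u v → eqV u v ≡ false → 2 ≤ symDiffCount code u v
code-separating-near (x , y) (x′ , y′) (near-x , near-y) u≢v =
  subst (2 ≤_) (sym reduced) (≤ᵇ⇒≤ 2 _ (unlessFalse (eqV u₀ v₀) u₀≢v₀ checked))
  where
  u = (x , y)
  v = (x′ , y′)
  d = periodShift u
  u₀ = representative u
  v₀ = (+ mod6 x ℤ.+ (x′ ℤ.- x) , + mod6 y ℤ.+ (y′ ℤ.- y))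
  cancel : ∀ a b c → (a ℤ.+ (c ℤ.- b)) ℤ.+ (b ℤ.- a) ≡ c
  cancel = ℤSolver.solve-∀
  v-translate : translate d v₀ ≡ v
  v-translate = cong₂ _,_ (cancel (+ mod6 x) x x′) (cancel (+ mod6 y) y y′)
  reduced : symDiffCount code u v ≡ symDiffCount code u₀ v₀
  reduced = trans (cong₂ (symDiffCount code) (sym (translate-representative u)) (sym v-translate))
    (trans (symDiffCount-translate code d u₀ v₀ (periodShift-even u)) (symDiffCount-cong u₀ v₀ (code-periodic u)))
  u₀≢v₀ : eqV u₀ v₀ ≡ false
  u₀≢v₀ = trans (sym (eqV-translate d u₀ v₀)) (trans (cong₂ eqV (translate-representative u) v-translate) u≢v)
  checked : separatedByCode u₀ v₀ ≡ true
  checked = allOffsets-sound (λ dy → separatedByCode u₀ (+ mod6 x ℤ.+ (x′ ℤ.- x) , + mod6 y ℤ.+ dy))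
    (allOffsets-sound (λ dx → allOffsets (λ dy → separatedByCode u₀ (+ mod6 x ℤ.+ dx , + mod6 y ℤ.+ dy)))
      (all<6²-mod6 (λ a b → allOffsets (λ dx → allOffsets (λ dy → separatedByCode (+ a , + b) (+ a ℤ.+ dx , + b ℤ.+ dy)))) refl x y)
      (x′ ℤ.- x) near-x)
    (y′ ℤ.- y) near-y
  unlessFalse : ∀ a {b} → a ≡ false → a ∨ b ≡ true → b ≡ true
  unlessFalse false _ h = h

code-separating-far : ∀ u v → ¬ Within 2 u v → 2 ≤ symDiffCount code u v
code-separating-far u v far =
  ≤-trans (subst (2 ≤_) (sym (exclusiveCount-far code u v far)) (code-dominating u)) (ℕP.m≤m+n _ _)

code-separating : ∀ u v → eqV u v ≡ false → 2 ≤ symDiffCount code u v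
code-separating (x , y) (x′ , y′) u≢v with ∣ x′ ℤ.- x ∣ ℕ.≤? 2 | ∣ y′ ℤ.- y ∣ ℕ.≤? 2
... | yes near-x | yes near-y = code-separating-near (x , y) (x′ , y′) (near-x , near-y) u≢v
... | no far-x | _ = code-separating-far (x , y) (x′ , y′) (λ w → far-x (proj₁ w))
... | yes _ | no far-y = code-separating-far (x , y) (x′ , y′) (λ w → far-y (proj₂ w))

code-IsREDIC : IsREDIC code
code-IsREDIC = code-dominating , code-separating

DownwardClosed : (ℕ → Bool) → Set
DownwardClosed P = ∀ i → P (suc i) ≡ true → P i ≡ true

AtMostTwoInThree : (ℕ → Bool) → Set
AtMostTwoInThree s = ∀ i → bit (s i) + bit (s (suc i)) + bit (s (suc (suc i))) ≤ 2

DownwardClosed-false : ∀ P → DownwardClosed P → ∀ k → P k ≡ false → ∀ i → P (k + i) ≡ false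
DownwardClosed-false P closed k Pk i = ¬-not (λ P[k+i] → not-¬ (stays k i P[k+i]) Pk)
  where
  stays : ∀ k i → P (k + i) ≡ true → P k ≡ true
  stays k zero h = subst (λ z → P z ≡ true) (ℕP.+-identityʳ k) h
  stays k (suc i) h = stays k i (closed (k + i) (subst (λ z → P z ≡ true) (+-suc k i) h))

3c≤2p+2 : ∀ c p → c ≤ p → p ≤ 2 → 3 * c ≤ 2 * p + 2
3c≤2p+2 c p c≤p p≤2 = ≤-trans (*-monoʳ-≤ 3 c≤p) (subst (_≤ 2 * p + 2) (3p p) (+-mono-≤ (≤-refl {2 * p}) p≤2))
  where
  3p : ∀ p → 2 * p + p ≡ 3 * p
  3p = ℕSolver.solve-∀

∑-initialSegment-≤ : ∀ n (P s : ℕ → Bool) → DownwardClosed P → AtMostTwoInThree s →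
  3 * ∑ n (λ i → bit (P i ∧ s i)) ≤ 2 * ∑ n (λ i → bit (P i)) + 2
∑-initialSegment-≤ zero P s closed sparse = z≤n
∑-initialSegment-≤ (suc zero) P s closed sparse =
  3c≤2p+2 _ _ (+-mono-≤ (bit-∧-≤ (P 0) (s 0)) z≤n) (+-mono-≤ (bit≤1 (P 0)) (z≤n {1}))
∑-initialSegment-≤ (suc (suc zero)) P s closed sparse =
  3c≤2p+2 _ _ (+-mono-≤ (bit-∧-≤ (P 0) (s 0)) (+-mono-≤ (bit-∧-≤ (P 1) (s 1)) z≤n))
              (+-mono-≤ (bit≤1 (P 0)) (+-mono-≤ (bit≤1 (P 1)) (z≤n {0})))
∑-initialSegment-≤ (suc (suc (suc n))) P s closed sparse = byP2 (P 2) refl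
  where
  C′ = ∑ n (λ i → bit (P (3 + i) ∧ s (3 + i)))
  P′ = ∑ n (λ i → bit (P (3 + i)))
  byP2 : ∀ b → P 2 ≡ b → 3 * ∑ (3 + n) (λ i → bit (P i ∧ s i)) ≤ 2 * ∑ (3 + n) (λ i → bit (P i)) + 2
  byP2 true P2 rewrite P2 | closed 1 P2 | closed 0 (closed 1 P2) = begin
    3 * (bit (s 0) + (bit (s 1) + (bit (s 2) + C′)))      ≡⟨ distribute (bit (s 0)) (bit (s 1)) (bit (s 2)) C′ ⟩
    3 * (bit (s 0) + bit (s 1) + bit (s 2)) + 3 * C′      ≤⟨ +-mono-≤ (*-monoʳ-≤ 3 (sparse 0))
                                                              (∑-initialSegment-≤ n (λ i → P (3 + i)) (λ i → s (3 + i)) (λ i → closed (3 + i)) (λ i → sparse (3 + i))) ⟩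
    6 + (2 * P′ + 2)                                      ≡⟨ collect P′ ⟩
    2 * (1 + (1 + (1 + P′))) + 2                          ∎
    where
    open ℕP.≤-Reasoning
    distribute : ∀ a b c C → 3 * (a + (b + (c + C))) ≡ 3 * (a + b + c) + 3 * C
    distribute = ℕSolver.solve-∀
    collect : ∀ P → 6 + (2 * P + 2) ≡ 2 * (1 + (1 + (1 + P))) + 2
    collect = ℕSolver.solve-∀
  byP2 false P2 rewrite P2
    | ∑-zero n {λ i → bit (P (3 + i) ∧ s (3 + i))} (λ i _ → cong (λ b → bit (b ∧ s (3 + i))) (DownwardClosed-false P closed 2 P2 (suc i)))
    | ∑-zero n {λ i → bit (P (3 + i))} (λ i _ → cong bit (DownwardClosed-false P closed 2 P2 (suc i))) =
    3c≤2p+2 _ _ (+-mono-≤ (bit-∧-≤ (P 0) (s 0)) (+-mono-≤ (bit-∧-≤ (P 1) (s 1)) z≤n))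
                (+-mono-≤ (bit≤1 (P 0)) (+-mono-≤ (bit≤1 (P 1)) (z≤n {0})))

code-AtMostTwoInThree : ∀ x y → bit (code (x , y)) + bit (code (x , y ℤ.+ + 1)) + bit (code (x , (y ℤ.+ + 1) ℤ.+ + 1)) ≤ 2
code-AtMostTwoInThree x y rewrite mod6-suc (y ℤ.+ + 1) | mod6-suc y = ≤ᵇ⇒≤ _ 2
  (all<6²-mod6 (λ a b → bit (inCodeMod6 a b) + bit (inCodeMod6 a (suc b % 6)) + bit (inCodeMod6 a (suc (suc b % 6) % 6)) ≤ᵇ 2) refl x y)

code-above : ∀ x → AtMostTwoInThree (λ i → code (x , + i))
code-above x i = subst₂ (λ a b → bit (code (x , + i)) + bit (code (x , a)) + bit (code (x , b)) ≤ 2)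
  (+suc≡ i) (trans (cong (ℤ._+ + 1) (+suc≡ i)) (+suc≡ (suc i))) (code-AtMostTwoInThree x (+ i))

code-below : ∀ x → AtMostTwoInThree (λ i → code (x , -[1+ i ]))
code-below x i = subst (_≤ 2) (reverse (bit (code (x , -[1+ suc (suc i) ]))) (bit (code (x , -[1+ suc i ]))) (bit (code (x , -[1+ i ]))))
  (code-AtMostTwoInThree x -[1+ suc (suc i) ])
  where
  reverse : ∀ a b c → a + b + c ≡ c + b + a
  reverse = ℕSolver.solve-∀

inBall-above-DownwardClosed : ∀ r x → DownwardClosed (λ i → inBall r (x , + i))
inBall-above-DownwardClosed r x i p = inBall-shrink-above r x i (inBall-suc r _ p)

inBall-below-DownwardClosed : ∀ r x → DownwardClosed (λ i → inBall r (x , -[1+ i ]))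
inBall-below-DownwardClosed r x i p = inBall-shrink-below r x (suc i) (inBall-suc r _ p)

∑-window-split : ∀ r (F : ℤ → ℕ) → ∑ (width r) (λ j → F (coord r j)) ≡ ∑ r (λ i → F -[1+ i ]) + ∑ (suc r) (λ i → F (+ i))
∑-window-split r F = begin
  ∑ (width r) (λ j → F (coord r j))                                         ≡⟨ cong (λ k → ∑ k (λ j → F (coord r j))) (sym (+-suc r r)) ⟩
  ∑ (r + suc r) (λ j → F (coord r j))                                       ≡⟨ ∑-+-range r (suc r) (λ j → F (coord r j)) ⟩
  ∑ r (λ j → F (coord r j)) + ∑ (suc r) (λ i → F (coord r (r + i)))         ≡⟨ cong₂ _+_ negative nonnegative ⟩
  ∑ r (λ i → F -[1+ i ]) + ∑ (suc r) (λ i → F (+ i))                        ∎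
  where
  open ≡-Reasoning
  negative = trans (∑-reverse r (λ j → F (coord r j))) (∑-cong r (λ i i<r → cong F (coord-neg r i i<r)))
  nonnegative = ∑-cong (suc r) (λ i _ → cong F (coord-+ r i))

code-column-≤ : ∀ r x → 3 * ∑ (width r) (λ j → bit (inBall r (x , coord r j) ∧ code (x , coord r j)))
                      ≤ 2 * ∑ (width r) (λ j → bit (inBall r (x , coord r j))) + 4
code-column-≤ r x = begin
  3 * ∑ (width r) (λ j → F (coord r j))   ≡⟨ cong (3 *_) (∑-window-split r F) ⟩
  3 * (L + U)                             ≡⟨ ℕP.*-distribˡ-+ 3 L U ⟩
  3 * L + 3 * U                           ≤⟨ +-mono-≤ (∑-initialSegment-≤ r (λ i → inBall r (x , -[1+ i ])) (λ i → code (x , -[1+ i ])) (inBall-below-DownwardClosed r x) (code-below x))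
                                                      (∑-initialSegment-≤ (suc r) (λ i → inBall r (x , + i)) (λ i → code (x , + i)) (inBall-above-DownwardClosed r x) (code-above x)) ⟩
  (2 * L′ + 2) + (2 * U′ + 2)             ≡⟨ collect L′ U′ ⟩
  2 * (L′ + U′) + 4                       ≡⟨ cong (λ z → 2 * z + 4) (sym (∑-window-split r G)) ⟩
  2 * ∑ (width r) (λ j → G (coord r j)) + 4 ∎
  where
  open ℕP.≤-Reasoning
  F G : ℤ → ℕ
  F y = bit (inBall r (x , y) ∧ code (x , y))
  G y = bit (inBall r (x , y))
  L = ∑ r (λ i → F -[1+ i ])
  U = ∑ (suc r) (λ i → F (+ i))
  L′ = ∑ r (λ i → G -[1+ i ])
  U′ = ∑ (suc r) (λ i → G (+ i))
  collect : ∀ a b → (2 * a + 2) + (2 * b + 2) ≡ 2 * (a + b) + 4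
  collect = ℕSolver.solve-∀

code-ballCount-upper : ∀ r → 3 * ballCount code r ≤ 2 * ballSize r + width r * 4
code-ballCount-upper r = begin
  3 * ballCount code r                                ≡⟨ cong (3 *_) (ballCount≡boxSum code r 0) ⟩
  3 * boxSum r F                                      ≡⟨ sym (∑-* (width r) 3 (column r F)) ⟩
  ∑ (width r) (λ i → 3 * column r F i)                ≤⟨ ∑-mono (width r) (λ i _ → code-column-≤ r (coord r i)) ⟩
  ∑ (width r) (λ i → 2 * column r G i + 4)            ≡⟨ ∑-+ (width r) (λ i → 2 * column r G i) (λ _ → 4) ⟩
  ∑ (width r) (λ i → 2 * column r G i) + ∑ (width r) (λ _ → 4) ≡⟨ cong₂ _+_ (∑-* (width r) 2 (column r G)) (∑-const (width r) 4) ⟩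
  2 * boxSum r G + width r * 4                        ≡⟨ cong (λ z → 2 * z + width r * 4) (sym (ballSize≡boxSum r 0)) ⟩
  2 * ballSize r + width r * 4                        ∎
  where
  open ℕP.≤-Reasoning
  F G : Vertex → ℕ
  F v = bit (inBall r v ∧ code v)
  G v = bit (inBall r v)

halve : ∀ r → 1 ≤ r → Σ ℕ λ h → suc (double h) ≤ r × r ≤ suc (suc (double h))
halve (suc zero) _ = 0 , ≤-refl , n≤1+n _
halve (suc (suc zero)) _ = 0 , n≤1+n _ , ≤-refl
halve (suc (suc (suc r))) _ with halve (suc r) (s≤s z≤n)
... | (h , lower , upper) = suc h , s≤s (s≤s lower) , s≤s (s≤s upper)

upper-boundary-negligible : ∀ K r → 14 * K + 2 ≤ r → K * (width r * 4) ≤ 3 * ballSize r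
upper-boundary-negligible K r 14K+2≤r with halve r (≤-trans (s≤s z≤n) (subst (_≤ r) (+-comm (14 * K) 2) 14K+2≤r))
... | (h , 2h<r , r≤2h+2) = begin
  K * (width r * 4)          ≤⟨ *-monoʳ-≤ K (*-monoˡ-≤ 4 width≤) ⟩
  K * (5 * suc h * 4)        ≡⟨ regroup K (suc h) ⟩
  (20 * K) * suc h           ≤⟨ *-monoˡ-≤ (suc h) 20K≤3[1+h] ⟩
  (3 * suc h) * suc h        ≡⟨ ℕP.*-assoc 3 (suc h) (suc h) ⟩
  3 * (suc h * suc h)        ≤⟨ *-monoʳ-≤ 3 (square≤ballSize r h 2h<r) ⟩
  3 * ballSize r             ∎
  where
  open ℕP.≤-Reasoning
  regroup : ∀ K s → K * (5 * s * 4) ≡ (20 * K) * s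
  regroup = ℕSolver.solve-∀
  7K≤h : 7 * K ≤ h
  7K≤h = double-cancel-≤ (7 * K) h (subst (_≤ double h) (sym (trans (double≡+ (7 * K)) (twice K)))
           (ℕP.+-cancelʳ-≤ 2 (14 * K) (double h) (≤-trans 14K+2≤r (subst (r ≤_) (+-comm 2 (double h)) r≤2h+2))))
    where
    twice : ∀ K → 7 * K + 7 * K ≡ 14 * K
    twice = ℕSolver.solve-∀
  width≤ : width r ≤ 5 * suc h
  width≤ = ≤-trans (s≤s (+-mono-≤ r≤2h+2 r≤2h+2))
    (subst (_≤ 5 * suc h) (sym (expand h)) (subst (5 + 4 * h ≤_) (collect h) (ℕP.m≤m+n (5 + 4 * h) h)))
    where
    expand : ∀ h → suc (suc (suc (double h)) + suc (suc (double h))) ≡ 5 + 4 * h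
    expand h = trans (cong (λ z → suc (suc (suc z) + suc (suc z))) (double≡+ h)) (solve h)
      where
      solve : ∀ h → suc (suc (suc (h + h)) + suc (suc (h + h))) ≡ 5 + 4 * h
      solve = ℕSolver.solve-∀
    collect : ∀ h → 5 + 4 * h + h ≡ 5 * suc h
    collect = ℕSolver.solve-∀
  20K≤3[1+h] : 20 * K ≤ 3 * suc h
  20K≤3[1+h] = ≤-trans (ℕP.m≤m+n (20 * K) K) (≤-trans (ℕP.≤-reflexive (expand K)) (*-monoʳ-≤ 3 (≤-trans 7K≤h (n≤1+n h))))
    where
    expand : ∀ K → 20 * K + K ≡ 3 * (7 * K)
    expand = ℕSolver.solve-∀

code-density≤2/3 : REDICDensityUpperBound 2 3
code-density≤2/3 k = code , code-IsREDIC , (14 * K + 2 , bound)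
  where
  K = suc k
  bound : ∀ r → 14 * K + 2 ≤ r → 3 * K * ballCount code r ≤ 2 * K * ballSize r + 3 * ballSize r
  bound r R≤r = begin
    3 * K * ballCount code r                  ≡⟨ commute K (ballCount code r) ⟩
    K * (3 * ballCount code r)                ≤⟨ *-monoʳ-≤ K (code-ballCount-upper r) ⟩
    K * (2 * ballSize r + width r * 4)        ≡⟨ distribute K (ballSize r) (width r) ⟩
    2 * K * ballSize r + K * (width r * 4)    ≤⟨ +-mono-≤ (≤-refl {2 * K * ballSize r}) (upper-boundary-negligible K r R≤r) ⟩
    2 * K * ballSize r + 3 * ballSize r       ∎
    where
    open ℕP.≤-Reasoning
    commute : ∀ K c → 3 * K * c ≡ K * (3 * c)
    commute = ℕSolver.solve-∀
    distribute : ∀ K b w → K * (2 * b + w * 4) ≡ 2 * K * b + K * (w * 4)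
    distribute = ℕSolver.solve-∀

theorem13 : REDICDensityLowerBound 4 7 × REDICDensityUpperBound 2 3
theorem13 = REDIC-density≥4/7 , code-density≤2/3
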